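{- Let $k\ge2$, $n\ge1$, and for $d\mid n$ define $$a_{k;n,d}(x)=\frac{x^d-1}{x^n-1}\sum_{m:\,d\mid m\mid n}\mu\Big(\frac md\Big)(-1)^{k(n-\frac nm)}x^{(k-2)\frac n2(\frac nm-1)}\in\mathbb{Q}(x),$$ $\mu$ the Möbius function. Then: (I) For every $d\mid n$, $a_{k;n,d}(x)\in\mathbb{Z}[x]$; if $d\notin\{n,\frac n2\}$ then $a_{k;n,d}(x)$ is divisible by $x^d-1$; moreover $a_{k;n,n}(x)=(-1)^{k(n-1)}$ and, when $n$ is even, $a_{k;n,n/2}(x)=\dfrac{x^{\frac{(k-2)n}{2}}+(-1)^{k+1}}{x^{\frac n2}+1}$. (II) If $k>2$, then $\deg a_{k;n,d}(x)=\frac{(n(k-2)-2d)(n-d)}{2d}$ and its leading coefficient is $(-1)^{k(n-\frac nd)}$. If $k=2$, then $a_{2;n,d}(x)=\delta_{n,d}$. (III) If $k>2$, then for every prime power $q$, $a_{k;n,d}(q)$ is a nonzero integer whose sign is that of $(-1)^{k(n-\frac nd)}$; i.e. it is positive unless $k$ is odd, $n$ is even and $2\nmid\frac nd$. -}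

module Defs where

open import Data.Nat as ℕ using (ℕ; zero; suc; _∸_; _≤_; _<_)
open import Data.Nat.DivMod using (_/_)
open import Data.Nat.Divisibility using (_∣_; _∣?_)
open import Data.Nat.Primality using (Prime; prime?)
open import Data.Integer as ℤ using (ℤ; +_; -_)
open import Data.List using (List; []; _∷_; filter; length; upTo; map; foldr; replicate; _++_)
open import Data.Bool using (Bool; true; false; if_then_else_; not; _∧_)
open import Data.Product using (_×_; Σ; ∃)
open import Relation.Nullary using (¬_; does; Dec; yes; no)
open import Relation.Nullary.Decidable using (_×-dec_)
open import Relation.Binary.PropositionalEquality using (_≡_; _≢_)

-- Natural-number division that returns 0 on a zero divisor
-- (only ever used with nonzero divisors in the statement).

_÷_ : ℕ → ℕ → ℕ
m ÷ zero  = 0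
m ÷ suc n = m / suc n

neg1^ : ℕ → ℤ
neg1^ zero    = + 1
neg1^ (suc e) = - neg1^ e

twoTo : ℕ → List ℕ
twoTo n = map (λ i → suc (suc i)) (upTo (n ∸ 1))

squarefree : ℕ → Bool
squarefree n = foldr (λ p b → not (does ((p ℕ.* p) ∣? n)) ∧ b) true (twoTo n)

ω : ℕ → ℕ
ω n = length (filter (λ p → prime? p ×-dec p ∣? n) (twoTo n))

μ : ℕ → ℤ
μ n = if squarefree n then neg1^ (ω n) else + 0

-- Polynomials in ℤ[x] as coefficient lists (lowest degree first).
-- Trailing zeros are allowed; equality is coefficientwise.

Poly : Set
Poly = List ℤ

coeff : Poly → ℕ → ℤ
coeff []       _       = + 0
coeff (c ∷ p)  zero    = c
coeff (c ∷ p)  (suc i) = coeff p i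

infix 4 _≈ₚ_
_≈ₚ_ : Poly → Poly → Set
p ≈ₚ q = ∀ i → coeff p i ≡ coeff q i

infixl 6 _+ₚ_ _-ₚ_
infixl 7 _*ₚ_ _·ₚ_

_+ₚ_ : Poly → Poly → Poly
[]      +ₚ q       = q
(a ∷ p) +ₚ []      = a ∷ p
(a ∷ p) +ₚ (b ∷ q) = (a ℤ.+ b) ∷ (p +ₚ q)

_·ₚ_ : ℤ → Poly → Poly
c ·ₚ p = map (c ℤ.*_) p

_-ₚ_ : Poly → Poly → Poly
p -ₚ q = p +ₚ ((- + 1) ·ₚ q)

_*ₚ_ : Poly → Poly → Poly
[]      *ₚ q = []
(a ∷ p) *ₚ q = (a ·ₚ q) +ₚ (+ 0 ∷ (p *ₚ q))

C : ℤ → Poly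
C c = c ∷ []

X^ : ℕ → Poly
X^ e = replicate e (+ 0) ++ (+ 1 ∷ [])

sumₚ : List Poly → Poly
sumₚ = foldr _+ₚ_ []

eval : Poly → ℤ → ℤ
eval []      x = + 0
eval (c ∷ p) x = c ℤ.+ x ℤ.* eval p x

HasDegLead : Poly → ℕ → ℤ → Set
HasDegLead p D c = (coeff p D ≡ c) × (c ≢ + 0) × (∀ i → D < i → coeff p i ≡ + 0)

-- The numerator sum
--   S_{k;n,d}(x) = Σ_{d ∣ m ∣ n} μ(m/d) (-1)^{k(n - n/m)} x^{(k-2)(n/2)(n/m - 1)}
-- (m ranges over 0..n; for n ≥ 1 only 1 ≤ m ≤ n satisfy m ∣ n).
-- The exponent (k-2)·n·(n/m - 1) is always even, so ÷ 2 is exact.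

S : ℕ → ℕ → ℕ → Poly
S k n d = sumₚ (map term (filter (λ m → d ∣? m ×-dec m ∣? n) (upTo (suc n))))
  where
  term : ℕ → Poly
  term m = (μ (m ÷ d) ℤ.* neg1^ (k ℕ.* (n ∸ (n ÷ m))))
             ·ₚ X^ (((k ∸ 2) ℕ.* n ℕ.* ((n ÷ m) ∸ 1)) ÷ 2)

-- a is the rational function a_{k;n,d}(x) = (x^d - 1) S(x) / (x^n - 1),
-- expressed (since x^n - 1 ≠ 0) by  a · (x^n - 1) = (x^d - 1) · S.
IsA : ℕ → ℕ → ℕ → Poly → Set
IsA k n d a = a *ₚ (X^ n -ₚ C (+ 1)) ≈ₚ (X^ d -ₚ C (+ 1)) *ₚ S k n d

IsPrimePower : ℕ → Set
IsPrimePower q = Σ ℕ λ p → Σ ℕ λ e → Prime p × 1 ≤ e × q ≡ p ℕ.^ e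

δ : {A : Set} → Dec A → ℤ
δ (yes _) = + 1
δ (no _)  = + 0

{-# OPTIONS --safe #-}
-- Write n = N d. The divisors m with d ∣ m ∣ n are m = j d with j ∣ N, and the term of S for
-- m = j d has exponent e_j = (k - 2)(n/2)(N/j - 1) = r_j + n q_j with r_j ∈ {0, n/2}. Since
-- x^{r + n q} = x^r + (xⁿ - 1)(x^r + x^{r+n} + ... + x^{r+n(q-1)}), this splits S = (xⁿ - 1) W + R
-- with R = Σ_{j ∣ N} μ(j) (-1)^{k(n - N/j)} x^{r_j}. The Möbius identities Σ_{j ∣ N} μ(j) = 0 (N ≥ 2)
-- and Σ_{j ∣ N, N/j even} μ(j) = 0 (N ≥ 3) make R vanish unless N ≤ 2, and in every case
-- (xᵈ - 1) R = R(0) (xⁿ - 1). Hence a = (xᵈ - 1) W + R(0) satisfies a (xⁿ - 1) = (xᵈ - 1) S, which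
-- gives (I). For k > 2 the exponents e_j strictly decrease in j, so the top coefficient of W comes
-- from the block of j = 1 alone, which gives (II); and at x = q ≥ 2 the term q^{e_1} of (±1) S(q)
-- outweighs the sum of the other, distinct and smaller, powers of q, which gives (III).
module Submission where

open import Defs
open import Data.Nat.Divisibility
open import Data.Nat.DivMod using (_/_; m*n/n≡m; n/1≡n)
open import Data.Nat.Primality
open import Data.Nat.Primality.Factorisation
open import Data.Nat.Coprimality using (Coprime; coprime-divisor)
import Data.Nat.Properties as ℕP
import Data.Nat.Tactic.RingSolver as NS
open import Data.Integer.Properties as ℤP using ()
open import Data.List using (List; []; _∷_; map; applyUpTo; filter; upTo; foldr; length)
open import Data.List.Relation.Unary.All using ([]; _∷_)
open import Data.Bool using (Bool; true; false; _∧_; not; if_then_else_; _xor_)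
import Data.Bool.Properties as BoolP
open import Data.Empty using (⊥-elim)
open import Data.Sum using (_⊎_; inj₁; inj₂)
open import Data.Product using (_×_; _,_; Σ; proj₁; proj₂)
open import Relation.Binary.PropositionalEquality
open import Relation.Nullary using (Dec; does; yes; no; ¬_; contradiction)
open import Relation.Nullary.Decidable using (dec-true; dec-false; _×-dec_)
open import Relation.Unary using (Pred; Decidable)

module _ where
  open import Data.Nat as ℕ using (ℕ; zero; suc; _≤_; _<_; z≤n; s≤s; _∸_; _≡ᵇ_)
  open import Data.Integer as ℤ using (ℤ; +_; -_; _+_; _*_)
  open import Data.Integer.Tactic.RingSolver using (solve-∀)

  -- Coefficient sequences and evaluation

  𝟙 : Bool → ℤ
  𝟙 true = + 1
  𝟙 false = + 0

  𝟙-refl : ∀ c → 𝟙 (c ≡ᵇ c) ≡ + 1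
  𝟙-refl zero = refl
  𝟙-refl (suc c) = 𝟙-refl c

  𝟙-≢ : ∀ i c → i ≢ c → 𝟙 (i ≡ᵇ c) ≡ + 0
  𝟙-≢ zero zero ne = ⊥-elim (ne refl)
  𝟙-≢ zero (suc c) ne = refl
  𝟙-≢ (suc i) zero ne = refl
  𝟙-≢ (suc i) (suc c) ne = 𝟙-≢ i c (λ e → ne (cong suc e))

  𝟙-suc : ∀ i a → 1 ≤ i → 𝟙 (i ≡ᵇ 0) * a ≡ + 0
  𝟙-suc (suc i) a _ = ℤP.*-zeroˡ a

  bit : Bool → ℕ
  bit true = 1
  bit false = 0

  shift : ℕ → (ℕ → ℤ) → ℕ → ℤ
  shift zero f i = f i
  shift (suc e) f zero = + 0
  shift (suc e) f (suc i) = shift e f i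

  shift-cong : ∀ e {f g : ℕ → ℤ} → (∀ i → f i ≡ g i) → ∀ i → shift e f i ≡ shift e g i
  shift-cong zero h i = h i
  shift-cong (suc e) h zero = refl
  shift-cong (suc e) h (suc i) = shift-cong e h i

  shift-zero : ∀ e i → shift e (λ _ → + 0) i ≡ + 0
  shift-zero zero i = refl
  shift-zero (suc e) zero = refl
  shift-zero (suc e) (suc i) = shift-zero e i

  shift-suc : ∀ e f i → shift 1 (shift e f) i ≡ shift (suc e) f i
  shift-suc e f zero = refl
  shift-suc e f (suc i) = refl

  shift-𝟙 : ∀ e c i → shift e (λ x → 𝟙 (x ≡ᵇ c)) i ≡ 𝟙 (i ≡ᵇ (e ℕ.+ c))
  shift-𝟙 zero c i = refl
  shift-𝟙 (suc e) c zero = refl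
  shift-𝟙 (suc e) c (suc i) = shift-𝟙 e c i

  shift-+ : ∀ e (f g : ℕ → ℤ) i → shift e (λ x → f x + g x) i ≡ shift e f i + shift e g i
  shift-+ zero f g i = refl
  shift-+ (suc e) f g zero = refl
  shift-+ (suc e) f g (suc i) = shift-+ e f g i

  shift-* : ∀ e c (f : ℕ → ℤ) i → shift e (λ x → c * f x) i ≡ c * shift e f i
  shift-* zero c f i = refl
  shift-* (suc e) c f zero = sym (ℤP.*-zeroʳ c)
  shift-* (suc e) c f (suc i) = shift-* e c f i

  shift-neg : ∀ e (f : ℕ → ℤ) i → shift e (λ x → - f x) i ≡ - shift e f i
  shift-neg zero f i = refl
  shift-neg (suc e) f zero = refl
  shift-neg (suc e) f (suc i) = shift-neg e f i

  shift-shift : ∀ a b (f : ℕ → ℤ) i → shift a (shift b f) i ≡ shift (a ℕ.+ b) f i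
  shift-shift zero b f i = refl
  shift-shift (suc a) b f zero = refl
  shift-shift (suc a) b f (suc i) = shift-shift a b f i

  shift-comm : ∀ a b (f : ℕ → ℤ) i → shift a (shift b f) i ≡ shift b (shift a f) i
  shift-comm a b f i = trans (shift-shift a b f i) (trans (cong (λ z → shift z f i) (ℕP.+-comm a b)) (sym (shift-shift b a f i)))

  shift-at : ∀ e (f : ℕ → ℤ) x → shift e f (e ℕ.+ x) ≡ f x
  shift-at zero f x = refl
  shift-at (suc e) f x = shift-at e f x

  coeff-+ₚ : ∀ p q i → coeff (p +ₚ q) i ≡ coeff p i + coeff q i
  coeff-+ₚ [] q i = sym (ℤP.+-identityˡ _)
  coeff-+ₚ (a ∷ p) [] i = sym (ℤP.+-identityʳ _)
  coeff-+ₚ (a ∷ p) (b ∷ q) zero = refl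
  coeff-+ₚ (a ∷ p) (b ∷ q) (suc i) = coeff-+ₚ p q i

  coeff-·ₚ : ∀ c p i → coeff (c ·ₚ p) i ≡ c * coeff p i
  coeff-·ₚ c [] i = sym (ℤP.*-zeroʳ c)
  coeff-·ₚ c (a ∷ p) zero = refl
  coeff-·ₚ c (a ∷ p) (suc i) = coeff-·ₚ c p i

  coeff-X^ : ∀ e i → coeff (X^ e) i ≡ 𝟙 (i ≡ᵇ e)
  coeff-X^ zero zero = refl
  coeff-X^ zero (suc i) = refl
  coeff-X^ (suc e) zero = refl
  coeff-X^ (suc e) (suc i) = coeff-X^ e i

  coeff-C : ∀ c i → coeff (C c) i ≡ 𝟙 (i ≡ᵇ 0) * c
  coeff-C c zero = sym (ℤP.*-identityˡ c)
  coeff-C c (suc i) = refl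

  coeff-[] : ∀ i → coeff [] i ≡ + 0
  coeff-[] zero = refl
  coeff-[] (suc i) = refl

  coeff-∷-*ₚ : ∀ a p q i → coeff ((a ∷ p) *ₚ q) i ≡ a * coeff q i + shift 1 (coeff (p *ₚ q)) i
  coeff-∷-*ₚ a p q zero = trans (coeff-+ₚ (a ·ₚ q) _ 0) (cong (_+ + 0) (coeff-·ₚ a q 0))
  coeff-∷-*ₚ a p q (suc i) = trans (coeff-+ₚ (a ·ₚ q) _ (suc i)) (cong (_+ coeff (p *ₚ q) i) (coeff-·ₚ a q (suc i)))

  coeff-*ₚ-distribʳ : ∀ p q r i → coeff ((p +ₚ q) *ₚ r) i ≡ coeff (p *ₚ r) i + coeff (q *ₚ r) i
  coeff-*ₚ-distribʳ [] q r i = sym (ℤP.+-identityˡ _)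
  coeff-*ₚ-distribʳ (a ∷ p) [] r i = sym (ℤP.+-identityʳ _)
  coeff-*ₚ-distribʳ (a ∷ p) (b ∷ q) r zero =
    trans (coeff-∷-*ₚ (a + b) (p +ₚ q) r 0)
    (trans (lem a b (coeff r 0))
    (sym (cong₂ _+_ (coeff-∷-*ₚ a p r 0) (coeff-∷-*ₚ b q r 0))))
    where
    lem : ∀ a b x → (a + b) * x + + 0 ≡ (a * x + + 0) + (b * x + + 0)
    lem = solve-∀
  coeff-*ₚ-distribʳ (a ∷ p) (b ∷ q) r (suc i) =
    trans (coeff-∷-*ₚ (a + b) (p +ₚ q) r (suc i))
    (trans (cong (λ z → (a + b) * coeff r (suc i) + z) (coeff-*ₚ-distribʳ p q r i))
    (trans (lem a b (coeff r (suc i)) (coeff (p *ₚ r) i) (coeff (q *ₚ r) i))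
    (sym (cong₂ _+_ (coeff-∷-*ₚ a p r (suc i)) (coeff-∷-*ₚ b q r (suc i))))))
    where
    lem : ∀ a b x u v → (a + b) * x + (u + v) ≡ (a * x + u) + (b * x + v)
    lem = solve-∀

  coeff-·ₚ-*ₚ : ∀ c p r i → coeff ((c ·ₚ p) *ₚ r) i ≡ c * coeff (p *ₚ r) i
  coeff-·ₚ-*ₚ c [] r i = trans (coeff-[] i) (sym (trans (cong (c *_) (coeff-[] i)) (ℤP.*-zeroʳ c)))
  coeff-·ₚ-*ₚ c (a ∷ p) r zero = trans (coeff-∷-*ₚ (c * a) (c ·ₚ p) r 0)
    (trans (lem c a (coeff r 0)) (cong (c *_) (sym (coeff-∷-*ₚ a p r 0))))
    where
    lem : ∀ c a x → c * a * x + + 0 ≡ c * (a * x + + 0)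
    lem = solve-∀
  coeff-·ₚ-*ₚ c (a ∷ p) r (suc i) = trans (coeff-∷-*ₚ (c * a) (c ·ₚ p) r (suc i))
    (trans (cong (λ z → c * a * coeff r (suc i) + z) (coeff-·ₚ-*ₚ c p r i))
    (trans (lem c a (coeff r (suc i)) (coeff (p *ₚ r) i)) (cong (c *_) (sym (coeff-∷-*ₚ a p r (suc i))))))
    where
    lem : ∀ c a x y → c * a * x + c * y ≡ c * (a * x + y)
    lem = solve-∀

  coeff-X^-*ₚ : ∀ e r i → coeff (X^ e *ₚ r) i ≡ shift e (coeff r) i
  coeff-X^-*ₚ zero r zero = trans (coeff-∷-*ₚ (+ 1) [] r 0) (trans (ℤP.+-identityʳ _) (ℤP.*-identityˡ _))
  coeff-X^-*ₚ zero r (suc i) = trans (coeff-∷-*ₚ (+ 1) [] r (suc i)) (trans (cong (λ z → + 1 * coeff r (suc i) + z) (coeff-[] i)) (trans (ℤP.+-identityʳ _) (ℤP.*-identityˡ _)))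
  coeff-X^-*ₚ (suc e) r zero = trans (coeff-∷-*ₚ (+ 0) (X^ e) r 0) refl
  coeff-X^-*ₚ (suc e) r (suc i) = trans (coeff-∷-*ₚ (+ 0) (X^ e) r (suc i)) (trans (ℤP.+-identityˡ _) (coeff-X^-*ₚ e r i))

  coeff-C-*ₚ : ∀ c r i → coeff (C c *ₚ r) i ≡ c * coeff r i
  coeff-C-*ₚ c r zero = trans (coeff-∷-*ₚ c [] r 0) (ℤP.+-identityʳ _)
  coeff-C-*ₚ c r (suc i) = trans (coeff-∷-*ₚ c [] r (suc i)) (trans (cong (λ z → c * coeff r (suc i) + z) (coeff-[] i)) (ℤP.+-identityʳ _))

  coeff-*ₚ-distribˡ : ∀ p q r i → coeff (p *ₚ (q +ₚ r)) i ≡ coeff (p *ₚ q) i + coeff (p *ₚ r) i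
  coeff-*ₚ-distribˡ [] q r i = trans (coeff-[] i) (sym (cong₂ _+_ (coeff-[] i) (coeff-[] i)))
  coeff-*ₚ-distribˡ (a ∷ p) q r zero = trans (coeff-∷-*ₚ a p (q +ₚ r) 0)
    (trans (cong (λ z → a * z + + 0) (coeff-+ₚ q r 0))
    (trans (lem a (coeff q 0) (coeff r 0)) (sym (cong₂ _+_ (coeff-∷-*ₚ a p q 0) (coeff-∷-*ₚ a p r 0)))))
    where
    lem : ∀ a x y → a * (x + y) + + 0 ≡ (a * x + + 0) + (a * y + + 0)
    lem = solve-∀
  coeff-*ₚ-distribˡ (a ∷ p) q r (suc i) = trans (coeff-∷-*ₚ a p (q +ₚ r) (suc i))
    (trans (cong₂ (λ z v → a * z + v) (coeff-+ₚ q r (suc i)) (coeff-*ₚ-distribˡ p q r i))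
    (trans (lem a (coeff q (suc i)) (coeff r (suc i)) _ _) (sym (cong₂ _+_ (coeff-∷-*ₚ a p q (suc i)) (coeff-∷-*ₚ a p r (suc i))))))
    where
    lem : ∀ a x y u v → a * (x + y) + (u + v) ≡ (a * x + u) + (a * y + v)
    lem = solve-∀

  shift-coeff-∷ : ∀ e a p i → shift e (coeff (a ∷ p)) i ≡ a * 𝟙 (i ≡ᵇ e) + shift 1 (shift e (coeff p)) i
  shift-coeff-∷ zero a p zero = sym (trans (ℤP.+-identityʳ _) (ℤP.*-identityʳ a))
  shift-coeff-∷ zero a p (suc i) = sym (trans (cong (λ z → z + coeff p i) (ℤP.*-zeroʳ a)) (ℤP.+-identityˡ _))
  shift-coeff-∷ (suc e) a p zero = sym (trans (ℤP.+-identityʳ _) (ℤP.*-zeroʳ a))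
  shift-coeff-∷ (suc e) a p (suc i) = trans (shift-coeff-∷ e a p i) (cong (λ z → a * 𝟙 (i ≡ᵇ e) + z) (shift-suc e (coeff p) i))

  coeff-*ₚ-X^ : ∀ p e i → coeff (p *ₚ X^ e) i ≡ shift e (coeff p) i
  coeff-*ₚ-X^ [] e i = trans (coeff-[] i) (sym (trans (shift-cong e coeff-[] i) (shift-zero e i)))
  coeff-*ₚ-X^ (a ∷ p) e i = trans (coeff-∷-*ₚ a p (X^ e) i)
    (trans (cong₂ (λ z v → a * z + v) (coeff-X^ e i) (shift-cong 1 (coeff-*ₚ-X^ p e) i)) (sym (shift-coeff-∷ e a p i)))

  coeff-*ₚ-·ₚ : ∀ c p q i → coeff (p *ₚ (c ·ₚ q)) i ≡ c * coeff (p *ₚ q) i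
  coeff-*ₚ-·ₚ c [] q i = trans (coeff-[] i) (sym (trans (cong (c *_) (coeff-[] i)) (ℤP.*-zeroʳ c)))
  coeff-*ₚ-·ₚ c (a ∷ p) q zero = trans (coeff-∷-*ₚ a p (c ·ₚ q) 0) (trans (cong (λ z → a * z + + 0) (coeff-·ₚ c q 0))
    (trans (lem a c (coeff q 0)) (cong (c *_) (sym (coeff-∷-*ₚ a p q 0)))))
    where
    lem : ∀ a c x → a * (c * x) + + 0 ≡ c * (a * x + + 0)
    lem = solve-∀
  coeff-*ₚ-·ₚ c (a ∷ p) q (suc i) = trans (coeff-∷-*ₚ a p (c ·ₚ q) (suc i)) (trans (cong₂ (λ z v → a * z + v) (coeff-·ₚ c q (suc i)) (coeff-*ₚ-·ₚ c p q i))
    (trans (lem a c (coeff q (suc i)) _) (cong (c *_) (sym (coeff-∷-*ₚ a p q (suc i))))))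
    where
    lem : ∀ a c x y → a * (c * x) + c * y ≡ c * (a * x + y)
    lem = solve-∀

  coeff-*ₚ-C : ∀ p c i → coeff (p *ₚ C c) i ≡ coeff p i * c
  coeff-*ₚ-C [] c i = trans (coeff-[] i) (sym (trans (cong (_* c) (coeff-[] i)) (ℤP.*-zeroˡ c)))
  coeff-*ₚ-C (a ∷ p) c zero = trans (coeff-∷-*ₚ a p (C c) 0) (ℤP.+-identityʳ _)
  coeff-*ₚ-C (a ∷ p) c (suc i) = trans (coeff-∷-*ₚ a p (C c) (suc i)) (trans (cong₂ (λ z v → a * z + v) (coeff-[] i) (coeff-*ₚ-C p c i)) (trans (cong (_+ coeff p i * c) (ℤP.*-zeroʳ a)) (ℤP.+-identityˡ _)))

  coeff-*ₚ-X^-1 : ∀ p e i → coeff (p *ₚ (X^ e -ₚ C (+ 1))) i ≡ shift e (coeff p) i + - coeff p i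
  coeff-*ₚ-X^-1 p e i = trans (coeff-*ₚ-distribˡ p (X^ e) _ i) (cong₂ _+_ (coeff-*ₚ-X^ p e i)
    (trans (coeff-*ₚ-·ₚ (- + 1) p (C (+ 1)) i) (trans (cong ((- + 1) *_) (coeff-*ₚ-C p (+ 1) i)) (trans (ℤP.-1*i≡-i _) (cong -_ (ℤP.*-identityʳ _))))))

  coeff-*ₚ-X^+1 : ∀ p e i → coeff (p *ₚ (X^ e +ₚ C (+ 1))) i ≡ shift e (coeff p) i + coeff p i
  coeff-*ₚ-X^+1 p e i = trans (coeff-*ₚ-distribˡ p (X^ e) _ i) (cong₂ _+_ (coeff-*ₚ-X^ p e i) (trans (coeff-*ₚ-C p (+ 1) i) (ℤP.*-identityʳ _)))

  coeff-X^-1-*ₚ : ∀ e r i → coeff ((X^ e -ₚ C (+ 1)) *ₚ r) i ≡ shift e (coeff r) i + - coeff r i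
  coeff-X^-1-*ₚ e r i = trans (coeff-*ₚ-distribʳ (X^ e) _ r i) (cong₂ _+_ (coeff-X^-*ₚ e r i)
    (trans (coeff-·ₚ-*ₚ (- + 1) (C (+ 1)) r i) (trans (cong ((- + 1) *_) (coeff-C-*ₚ (+ 1) r i)) (trans (ℤP.-1*i≡-i _) (cong -_ (ℤP.*-identityˡ _))))))

  eval-+ₚ : ∀ p q x → eval (p +ₚ q) x ≡ eval p x + eval q x
  eval-+ₚ [] q x = sym (ℤP.+-identityˡ _)
  eval-+ₚ (a ∷ p) [] x = sym (ℤP.+-identityʳ _)
  eval-+ₚ (a ∷ p) (b ∷ q) x = trans (cong (λ z → a + b + x * z) (eval-+ₚ p q x)) (lem a b x (eval p x) (eval q x))
    where
    lem : ∀ a b x u v → a + b + x * (u + v) ≡ a + x * u + (b + x * v)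
    lem = solve-∀

  eval-·ₚ : ∀ c p x → eval (c ·ₚ p) x ≡ c * eval p x
  eval-·ₚ c [] x = sym (ℤP.*-zeroʳ c)
  eval-·ₚ c (a ∷ p) x = trans (cong (λ z → c * a + x * z) (eval-·ₚ c p x)) (lem c a x (eval p x))
    where
    lem : ∀ c a x u → c * a + x * (c * u) ≡ c * (a + x * u)
    lem = solve-∀

  eval-*ₚ : ∀ p q x → eval (p *ₚ q) x ≡ eval p x * eval q x
  eval-*ₚ [] q x = sym (ℤP.*-zeroˡ (eval q x))
  eval-*ₚ (a ∷ p) q x = trans (eval-+ₚ (a ·ₚ q) _ x) (trans (cong₂ (λ z v → z + (+ 0 + x * v)) (eval-·ₚ a q x) (eval-*ₚ p q x))
    (lem a x (eval p x) (eval q x)))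
    where
    lem : ∀ a x u v → a * v + (+ 0 + x * (u * v)) ≡ (a + x * u) * v
    lem = solve-∀

  eval-X^ : ∀ e x → eval (X^ e) x ≡ x ℤ.^ e
  eval-X^ zero x = trans (cong (λ z → + 1 + z) (ℤP.*-zeroʳ x)) refl
  eval-X^ (suc e) x = trans (ℤP.+-identityˡ _) (cong (x *_) (eval-X^ e x))

  eval-C : ∀ c x → eval (C c) x ≡ c
  eval-C c x = trans (cong (λ z → c + z) (ℤP.*-zeroʳ x)) (ℤP.+-identityʳ c)

  eval-vanishing : ∀ p x → (∀ i → coeff p i ≡ + 0) → eval p x ≡ + 0
  eval-vanishing [] x h = refl
  eval-vanishing (a ∷ p) x h = trans (cong₂ (λ z v → z + x * v) (h 0) (eval-vanishing p x (λ i → h (suc i)))) (trans (ℤP.+-identityˡ _) (ℤP.*-zeroʳ x))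

  eval-≈ₚ : ∀ p q x → p ≈ₚ q → eval p x ≡ eval q x
  eval-≈ₚ [] q x h = sym (eval-vanishing q x (λ i → trans (sym (h i)) (coeff-[] i)))
  eval-≈ₚ (a ∷ p) [] x h = eval-vanishing (a ∷ p) x (λ i → trans (h i) (coeff-[] i))
  eval-≈ₚ (a ∷ p) (b ∷ q) x h = cong₂ (λ z v → z + x * v) (h 0) (eval-≈ₚ p q x (λ i → h (suc i)))

  eval-X^-1 : ∀ e x → eval (X^ e -ₚ C (+ 1)) x ≡ x ℤ.^ e + - + 1
  eval-X^-1 e x = trans (eval-+ₚ (X^ e) _ x) (cong₂ _+_ (eval-X^ e x) (trans (eval-·ₚ (- + 1) (C (+ 1)) x) (cong (- + 1 *_) (eval-C (+ 1) x))))

  geometric : ℕ → ℕ → ℕ → Poly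
  geometric r n zero = []
  geometric r n (suc q) = X^ (r ℕ.+ n ℕ.* q) +ₚ geometric r n q

  coeff-geometric-suc : ∀ r n q i → coeff (geometric r n (suc q)) i ≡ 𝟙 (i ≡ᵇ (r ℕ.+ n ℕ.* q)) + coeff (geometric r n q) i
  coeff-geometric-suc r n q i = trans (coeff-+ₚ (X^ (r ℕ.+ n ℕ.* q)) _ i) (cong (λ z → z + coeff (geometric r n q) i) (coeff-X^ _ i))

  geometric-telescopes : ∀ r n q i → shift n (coeff (geometric r n q)) i + - coeff (geometric r n q) i ≡ 𝟙 (i ≡ᵇ (r ℕ.+ n ℕ.* q)) + - 𝟙 (i ≡ᵇ r)
  geometric-telescopes r n zero i = begin
    shift n (coeff []) i + - coeff [] i         ≡⟨ cong₂ (λ x y → x + - y) (trans (shift-cong n coeff-[] i) (shift-zero n i)) (coeff-[] i) ⟩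
    + 0                                         ≡⟨ sym (ℤP.+-inverseʳ (𝟙 (i ≡ᵇ r))) ⟩
    𝟙 (i ≡ᵇ r) + - 𝟙 (i ≡ᵇ r)                   ≡⟨ cong (λ m → 𝟙 (i ≡ᵇ m) + - 𝟙 (i ≡ᵇ r)) (sym r+n*0≡r) ⟩
    𝟙 (i ≡ᵇ (r ℕ.+ n ℕ.* 0)) + - 𝟙 (i ≡ᵇ r)     ∎
    where
    open ≡-Reasoning
    r+n*0≡r : r ℕ.+ n ℕ.* 0 ≡ r
    r+n*0≡r = trans (cong (r ℕ.+_) (ℕP.*-zeroʳ n)) (ℕP.+-identityʳ r)
  geometric-telescopes r n (suc q) i = begin
      shift n (coeff (geometric r n (suc q))) i + - coeff (geometric r n (suc q)) i
    ≡⟨ cong₂ (λ a b → a + - b) (trans (shift-cong n (coeff-geometric-suc r n q) i) (trans (shift-+ n _ _ i) (cong (λ z → z + shift n (coeff (geometric r n q)) i) (shift-𝟙 n _ i)))) (coeff-geometric-suc r n q i) ⟩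
      (𝟙 (i ≡ᵇ (n ℕ.+ (r ℕ.+ n ℕ.* q))) + shift n (coeff (geometric r n q)) i) + - (𝟙 (i ≡ᵇ (r ℕ.+ n ℕ.* q)) + coeff (geometric r n q) i)
    ≡⟨ lem (𝟙 (i ≡ᵇ (n ℕ.+ (r ℕ.+ n ℕ.* q)))) (shift n (coeff (geometric r n q)) i) (𝟙 (i ≡ᵇ (r ℕ.+ n ℕ.* q))) (coeff (geometric r n q) i) ⟩
      𝟙 (i ≡ᵇ (n ℕ.+ (r ℕ.+ n ℕ.* q))) + (shift n (coeff (geometric r n q)) i + - coeff (geometric r n q) i) + - 𝟙 (i ≡ᵇ (r ℕ.+ n ℕ.* q))
    ≡⟨ cong (λ z → 𝟙 (i ≡ᵇ (n ℕ.+ (r ℕ.+ n ℕ.* q))) + z + - 𝟙 (i ≡ᵇ (r ℕ.+ n ℕ.* q))) (geometric-telescopes r n q i) ⟩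
      𝟙 (i ≡ᵇ (n ℕ.+ (r ℕ.+ n ℕ.* q))) + (𝟙 (i ≡ᵇ (r ℕ.+ n ℕ.* q)) + - 𝟙 (i ≡ᵇ r)) + - 𝟙 (i ≡ᵇ (r ℕ.+ n ℕ.* q))
    ≡⟨ lem2 (𝟙 (i ≡ᵇ (n ℕ.+ (r ℕ.+ n ℕ.* q)))) (𝟙 (i ≡ᵇ (r ℕ.+ n ℕ.* q))) (𝟙 (i ≡ᵇ r)) ⟩
      𝟙 (i ≡ᵇ (n ℕ.+ (r ℕ.+ n ℕ.* q))) + - 𝟙 (i ≡ᵇ r)
    ≡⟨ cong (λ z → 𝟙 (i ≡ᵇ z) + - 𝟙 (i ≡ᵇ r)) (nlem n r q) ⟩
      𝟙 (i ≡ᵇ (r ℕ.+ n ℕ.* suc q)) + - 𝟙 (i ≡ᵇ r) ∎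
    where
    open ≡-Reasoning
    lem : ∀ a b c d → (a + b) + - (c + d) ≡ a + (b + - d) + - c
    lem = solve-∀
    lem2 : ∀ a b c → a + (b + - c) + - b ≡ a + - c
    lem2 = solve-∀
    nlem : ∀ n r q → n ℕ.+ (r ℕ.+ n ℕ.* q) ≡ r ℕ.+ n ℕ.* suc q
    nlem = NS.solve-∀

  coeff-geometric-above : ∀ r n q i → r ℕ.+ n ℕ.* q < i ℕ.+ n → coeff (geometric r n q) i ≡ + 0
  coeff-geometric-above r n zero i lt = coeff-[] i
  coeff-geometric-above r n (suc q) i lt = trans (coeff-geometric-suc r n q i) (cong₂ _+_ (𝟙-≢ i _ (λ e → ℕP.<-irrefl (sym e) lt1)) (coeff-geometric-above r n q i (ℕP.<-≤-trans lt1 (ℕP.m≤m+n i n))))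
    where
    lt1 : r ℕ.+ n ℕ.* q < i
    lt1 = ℕP.+-cancelʳ-< _ _ _ (subst (λ z → z < i ℕ.+ n) (nl r n q) lt)
      where
      nl : ∀ r n q → r ℕ.+ n ℕ.* suc q ≡ r ℕ.+ n ℕ.* q ℕ.+ n
      nl = NS.solve-∀

  coeff-geometric-top : ∀ r n q → 1 ≤ n → coeff (geometric r n (suc q)) (r ℕ.+ n ℕ.* q) ≡ + 1
  coeff-geometric-top r n q n≥1 = trans (coeff-geometric-suc r n q (r ℕ.+ n ℕ.* q)) (trans (cong₂ _+_ (𝟙-refl (r ℕ.+ n ℕ.* q)) (coeff-geometric-above r n q _ (ℕP.m<m+n (r ℕ.+ n ℕ.* q) n≥1))) refl)

  coeff-geometric-top′ : ∀ r n q E → 1 ≤ n → r < n → n ≤ E → E ≡ r ℕ.+ n ℕ.* q → coeff (geometric r n q) (E ∸ n) ≡ + 1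
  coeff-geometric-top′ r n zero E n≥1 r<n n≤E eq = ⊥-elim (ℕP.<⇒≱ (ℕP.≤-<-trans (ℕP.≤-reflexive (trans eq (trans (cong (r ℕ.+_) (ℕP.*-zeroʳ n)) (ℕP.+-identityʳ r)))) r<n) n≤E)
  coeff-geometric-top′ r n (suc q) E n≥1 r<n n≤E eq = trans (cong (λ z → coeff (geometric r n (suc q)) z) e2) (coeff-geometric-top r n q n≥1)
    where
    e2 : E ∸ n ≡ r ℕ.+ n ℕ.* q
    e2 = trans (cong (_∸ n) (trans eq (lem r n q))) (ℕP.m+n∸n≡m (r ℕ.+ n ℕ.* q) n)
      where
      lem : ∀ r n q → r ℕ.+ n ℕ.* suc q ≡ r ℕ.+ n ℕ.* q ℕ.+ n
      lem = NS.solve-∀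

  sumMap : (ℕ → ℤ) → List ℕ → ℤ
  sumMap f [] = + 0
  sumMap f (m ∷ L) = f m + sumMap f L

  coeff-sumₚ : ∀ (t : ℕ → Poly) L i → coeff (sumₚ (map t L)) i ≡ sumMap (λ m → coeff (t m) i) L
  coeff-sumₚ t [] i = coeff-[] i
  coeff-sumₚ t (m ∷ L) i = trans (coeff-+ₚ (t m) _ i) (cong (λ z → coeff (t m) i + z) (coeff-sumₚ t L i))

  eval-sumₚ : ∀ (t : ℕ → Poly) L x → eval (sumₚ (map t L)) x ≡ sumMap (λ m → eval (t m) x) L
  eval-sumₚ t [] x = refl
  eval-sumₚ t (m ∷ L) x = trans (eval-+ₚ (t m) _ x) (cong (λ z → eval (t m) x + z) (eval-sumₚ t L x))

  sumMap-filter-cong : ∀ {ℓ} {P : Pred ℕ ℓ} (P? : Decidable P) xs (f g : ℕ → ℤ) → (∀ x → P x → f x ≡ g x) → sumMap f (filter P? xs) ≡ sumMap g (filter P? xs)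
  sumMap-filter-cong P? [] f g h = refl
  sumMap-filter-cong P? (x ∷ xs) f g h with P? x
  ... | yes p = cong₂ _+_ (h x p) (sumMap-filter-cong P? xs f g h)
  ... | no _ = sumMap-filter-cong P? xs f g h

  sumMap-cong : ∀ (f g : ℕ → ℤ) L → (∀ m → f m ≡ g m) → sumMap f L ≡ sumMap g L
  sumMap-cong f g [] h = refl
  sumMap-cong f g (m ∷ L) h = cong₂ _+_ (h m) (sumMap-cong f g L h)

  sumMap-+ : ∀ (f g : ℕ → ℤ) L → sumMap (λ m → f m + g m) L ≡ sumMap f L + sumMap g L
  sumMap-+ f g [] = refl
  sumMap-+ f g (m ∷ L) = trans (cong (λ z → f m + g m + z) (sumMap-+ f g L)) (lem (f m) (g m) _ _)
    where
    lem : ∀ a b c d → a + b + (c + d) ≡ a + c + (b + d)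
    lem = solve-∀

  sumMap-neg : ∀ (f : ℕ → ℤ) L → sumMap (λ m → - f m) L ≡ - sumMap f L
  sumMap-neg f [] = refl
  sumMap-neg f (m ∷ L) = trans (cong (λ z → - f m + z) (sumMap-neg f L)) (sym (ℤP.neg-distrib-+ (f m) _))

  shift-sumMap : ∀ e (F : ℕ → ℕ → ℤ) L i → shift e (λ x → sumMap (F x) L) i ≡ sumMap (λ m → shift e (λ x → F x m) i) L
  shift-sumMap e F [] i = shift-zero e i
  shift-sumMap e F (m ∷ L) i = trans (shift-+ e (λ x → F x m) (λ x → sumMap (F x) L) i) (cong (λ z → shift e (λ x → F x m) i + z) (shift-sumMap e F L i))

  -- Finite sums

  when : Bool → ℤ → ℤ
  when true z = z
  when false z = + 0

  when-0 : ∀ b → when b (+ 0) ≡ + 0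
  when-0 true = refl
  when-0 false = refl

  when-split : ∀ c b z → when b z ≡ when c (when b z) + when (not c) (when b z)
  when-split true b z = sym (ℤP.+-identityʳ _)
  when-split false b z = sym (ℤP.+-identityˡ _)

  when-cond : ∀ c {x y : ℤ} → (c ≡ false → x ≡ y) → when (not c) x ≡ when (not c) y
  when-cond true f = refl
  when-cond false f = f refl

  when-swap : ∀ a b z → when a (when b z) ≡ when b (when a z)
  when-swap true true z = refl
  when-swap true false z = refl
  when-swap false true z = refl
  when-swap false false z = refl

  when* : ∀ b z c → when b z * c ≡ when b (z * c)
  when* true z c = refl
  when* false z c = ℤP.*-zeroˡ c

  when-sum : ∀ b z → when b z + when (not b) z ≡ z
  when-sum true z = ℤP.+-identityʳ z
  when-sum false z = ℤP.+-identityˡ z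

  when-does : ∀ {A : Set} (d : Dec A) z → (A → z ≡ + 0) → when (does d) z ≡ + 0
  when-does (yes a) z h = h a
  when-does (no _) z h = refl

  dec-sound : ∀ {A : Set} (d : Dec A) → does d ≡ true → A
  dec-sound (yes a) _ = a
  dec-sound (no _) ()

  when-pos : ∀ b x → when b (+ x) ≡ + (if b then x else 0)
  when-pos true x = refl
  when-pos false x = refl

  opaque
    sumTo : ℕ → (ℕ → ℤ) → ℤ
    sumTo zero h = + 0
    sumTo (suc l) h = h 0 + sumTo l (λ i → h (suc i))

    sumTo-suc : ∀ l (h : ℕ → ℤ) → sumTo (suc l) h ≡ h 0 + sumTo l (λ i → h (suc i))
    sumTo-suc l h = refl

    sumTo-0 : ∀ (h : ℕ → ℤ) → sumTo 0 h ≡ + 0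
    sumTo-0 h = refl

    sumTo-cong : ∀ l {h g : ℕ → ℤ} → (∀ i → i < l → h i ≡ g i) → sumTo l h ≡ sumTo l g
    sumTo-cong zero e = refl
    sumTo-cong (suc l) e = cong₂ _+_ (e 0 (s≤s z≤n)) (sumTo-cong l (λ i i<l → e (suc i) (s≤s i<l)))

    sumTo-zero : ∀ l {h : ℕ → ℤ} → (∀ i → i < l → h i ≡ + 0) → sumTo l h ≡ + 0
    sumTo-zero zero e = refl
    sumTo-zero (suc l) e = trans (cong₂ _+_ (e 0 (s≤s z≤n)) (sumTo-zero l (λ i i<l → e (suc i) (s≤s i<l)))) refl

    sumTo-+ : ∀ l (h g : ℕ → ℤ) → sumTo l (λ i → h i + g i) ≡ sumTo l h + sumTo l g
    sumTo-+ zero h g = refl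
    sumTo-+ (suc l) h g = trans (cong (λ z → h 0 + g 0 + z) (sumTo-+ l _ _)) (lem (h 0) (g 0) _ _)
      where
      lem : ∀ a b c d → a + b + (c + d) ≡ a + c + (b + d)
      lem = solve-∀

    sumTo-* : ∀ l c (h : ℕ → ℤ) → sumTo l (λ i → c * h i) ≡ c * sumTo l h
    sumTo-* zero c h = sym (ℤP.*-zeroʳ c)
    sumTo-* (suc l) c h = trans (cong (λ z → c * h 0 + z) (sumTo-* l c _)) (sym (ℤP.*-distribˡ-+ c (h 0) _))

    sumTo-split : ∀ a b (h : ℕ → ℤ) → sumTo (a ℕ.+ b) h ≡ sumTo a h + sumTo b (λ i → h (a ℕ.+ i))
    sumTo-split zero b h = sym (ℤP.+-identityˡ _)
    sumTo-split (suc a) b h = trans (cong (λ z → h 0 + z) (sumTo-split a b (λ i → h (suc i)))) (sym (ℤP.+-assoc (h 0) _ _))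

    filter-sum : ∀ {ℓ} {P : Pred ℕ ℓ} (P? : Decidable P) (f : ℕ → ℤ) (g : ℕ → ℕ) l →
      sumMap f (filter P? (applyUpTo g l)) ≡ sumTo l (λ i → when (does (P? (g i))) (f (g i)))
    filter-sum P? f g zero = refl
    filter-sum P? f g (suc l) with does (P? (g 0))
    ... | true = cong (λ z → f (g 0) + z) (filter-sum P? f (λ i → g (suc i)) l)
    ... | false = trans (filter-sum P? f (λ i → g (suc i)) l) (sym (ℤP.+-identityˡ _))

    when-∧ : ∀ a b z → when (a ∧ b) z ≡ when a (when b z)
    when-∧ true b z = refl
    when-∧ false b z = refl

    does-iff : ∀ {A B : Set} (a? : Dec A) (b? : Dec B) → (A → B) → (B → A) → does a? ≡ does b?
    does-iff a? (yes b) f g = dec-true a? (g b)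
    does-iff a? (no ¬b) f g = dec-false a? (λ a → ¬b (f a))

    sumTo-multiples-head : ∀ c' (G : ℕ → ℤ) → sumTo (suc c') (λ i → when (does (suc c' ∣? i)) (G i)) ≡ G 0
    sumTo-multiples-head c' G = trans (cong₂ _+_ (cong (λ b → when b (G 0)) (dec-true (suc c' ∣? 0) (_ ∣0)))
      (sumTo-zero c' (λ i i<c' → cong (λ b → when b (G (suc i))) (dec-false (suc c' ∣? suc i) (λ c∣ → ℕP.<⇒≱ (s≤s i<c') (∣⇒≤ c∣))))))
      (ℤP.+-identityʳ _)

    sumTo-multiples : ∀ c' K (G : ℕ → ℤ) → sumTo (suc (K ℕ.* suc c')) (λ i → when (does (suc c' ∣? i)) (G i)) ≡ sumTo (suc K) (λ j → G (j ℕ.* suc c'))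
    sumTo-multiples c' zero G = cong (λ b → when b (G 0) + + 0) (dec-true (suc c' ∣? 0) (_ ∣0))
    sumTo-multiples c' (suc K) G = trans (cong (λ z → sumTo z h) (sym (ℕP.+-suc (suc c') (K ℕ.* suc c'))))
      (trans (sumTo-split (suc c') (suc (K ℕ.* suc c')) h)
      (cong₂ _+_ (sumTo-multiples-head c' G) (trans (sumTo-cong (suc (K ℕ.* suc c')) (λ i _ → cong (λ b → when b (G (suc c' ℕ.+ i))) (shiftdiv i)))
         (sumTo-multiples c' K (λ i → G (suc c' ℕ.+ i))))))
      where
      h : ℕ → ℤ
      h i = when (does (suc c' ∣? i)) (G i)
      shiftdiv : ∀ i → does (suc c' ∣? (suc c' ℕ.+ i)) ≡ does (suc c' ∣? i)
      shiftdiv i = does-iff (suc c' ∣? (suc c' ℕ.+ i)) (suc c' ∣? i) (λ q → ∣m+n∣m⇒∣n q ∣-refl) (λ p → ∣m∣n⇒∣m+n ∣-refl p)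

    sumTo-neg : ∀ l (h : ℕ → ℤ) → sumTo l (λ i → - h i) ≡ - sumTo l h
    sumTo-neg zero h = refl
    sumTo-neg (suc l) h = trans (cong (λ z → - h 0 + z) (sumTo-neg l _)) (sym (ℤP.neg-distrib-+ (h 0) _))

  sumTo-truncate : ∀ M extra (h : ℕ → ℤ) → (∀ i → h (suc M ℕ.+ i) ≡ + 0) → sumTo (suc M ℕ.+ extra) h ≡ sumTo (suc M) h
  sumTo-truncate M extra h z = trans (sumTo-split (suc M) extra h) (trans (cong (λ v → sumTo (suc M) h + v) (sumTo-zero extra (λ i _ → z i))) (ℤP.+-identityʳ _))

  sumTo-mono : ∀ l (f g : ℕ → ℤ) → (∀ i → i < l → f i ℤ.≤ g i) → sumTo l f ℤ.≤ sumTo l g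
  sumTo-mono zero f g h = ℤP.≤-reflexive (trans (sumTo-0 f) (sym (sumTo-0 g)))
  sumTo-mono (suc l) f g h = subst₂ ℤ._≤_ (sym (sumTo-suc l f)) (sym (sumTo-suc l g))
    (ℤP.+-mono-≤ (h 0 (s≤s z≤n)) (sumTo-mono l _ _ (λ i i<l → h (suc i) (s≤s i<l))))

  sumToℕ : ℕ → (ℕ → ℕ) → ℕ
  sumToℕ zero h = 0
  sumToℕ (suc l) h = h 0 ℕ.+ sumToℕ l (λ i → h (suc i))

  sumToℕ-cong : ∀ l {h g : ℕ → ℕ} → (∀ i → i < l → h i ≡ g i) → sumToℕ l h ≡ sumToℕ l g
  sumToℕ-cong zero e = refl
  sumToℕ-cong (suc l) e = cong₂ ℕ._+_ (e 0 (s≤s z≤n)) (sumToℕ-cong l (λ i i<l → e (suc i) (s≤s i<l)))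

  sumToℕ-+ : ∀ l (h g : ℕ → ℕ) → sumToℕ l (λ i → h i ℕ.+ g i) ≡ sumToℕ l h ℕ.+ sumToℕ l g
  sumToℕ-+ zero h g = refl
  sumToℕ-+ (suc l) h g = trans (cong (λ z → h 0 ℕ.+ g 0 ℕ.+ z) (sumToℕ-+ l _ _)) (lem (h 0) (g 0) _ _)
    where
    lem : ∀ a b c d → a ℕ.+ b ℕ.+ (c ℕ.+ d) ≡ a ℕ.+ c ℕ.+ (b ℕ.+ d)
    lem = NS.solve-∀

  sumToℕ-split : ∀ a b (h : ℕ → ℕ) → sumToℕ (a ℕ.+ b) h ≡ sumToℕ a h ℕ.+ sumToℕ b (λ i → h (a ℕ.+ i))
  sumToℕ-split zero b h = refl
  sumToℕ-split (suc a) b h = trans (cong (λ z → h 0 ℕ.+ z) (sumToℕ-split a b (λ i → h (suc i)))) (sym (ℕP.+-assoc (h 0) _ _))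

  sumToℕ-zero : ∀ l {h : ℕ → ℕ} → (∀ i → i < l → h i ≡ 0) → sumToℕ l h ≡ 0
  sumToℕ-zero zero e = refl
  sumToℕ-zero (suc l) e = cong₂ ℕ._+_ (e 0 (s≤s z≤n)) (sumToℕ-zero l (λ i i<l → e (suc i) (s≤s i<l)))

  sumToℕ-bit-≡ᵇ : ∀ M c → c < M → sumToℕ M (λ i → bit (i ≡ᵇ c)) ≡ 1
  sumToℕ-bit-≡ᵇ (suc M) zero _ = cong suc (sumToℕ-zero M (λ i _ → refl))
  sumToℕ-bit-≡ᵇ (suc M) (suc c) (s≤s c<M) = sumToℕ-bit-≡ᵇ M c c<M

  length-filter : ∀ {ℓ} {P : ℕ → Set ℓ} (P? : ∀ x → Dec (P x)) (f g : ℕ → ℕ) l →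
    length (filter P? (map f (applyUpTo g l))) ≡ sumToℕ l (λ i → bit (does (P? (f (g i)))))
  length-filter P? f g zero = refl
  length-filter P? f g (suc l) with does (P? (f (g 0)))
  ... | true = cong suc (length-filter P? f (λ i → g (suc i)) l)
  ... | false = length-filter P? f (λ i → g (suc i)) l

  sumTo-+ℕ : ∀ l (h : ℕ → ℕ) → sumTo l (λ i → + h i) ≡ + sumToℕ l h
  sumTo-+ℕ zero h = sumTo-0 _
  sumTo-+ℕ (suc l) h = trans (sumTo-suc l _) (trans (cong (λ z → + h 0 + z) (sumTo-+ℕ l (λ i → h (suc i)))) (sym (ℤP.pos-+ (h 0) _)))

  sum-of-distinct-powers< : ∀ q → 2 ≤ q → ∀ l (P : ℕ → Bool) (g : ℕ → ℕ) B →
    (∀ i → i < l → P i ≡ true → g i < B) →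
    (∀ i i' → i < i' → i' < l → P i ≡ true → P i' ≡ true → g i' < g i) →
    sumToℕ l (λ i → if P i then q ℕ.^ g i else 0) < q ℕ.^ B
  sum-of-distinct-powers< q q≥2 zero P g B h1 h2 = ℕP.m^n>0 q {{ℕ.>-nonZero (ℕP.≤-trans (s≤s z≤n) q≥2)}} B
  sum-of-distinct-powers< q q≥2 (suc l) P g B h1 h2 with P 0 in e0
  ... | false = sum-of-distinct-powers< q q≥2 l (λ i → P (suc i)) (λ i → g (suc i)) B (λ i i<l → h1 (suc i) (s≤s i<l)) (λ i i' lt lt' → h2 (suc i) (suc i') (s≤s lt) (s≤s lt'))
  ... | true = ℕP.<-≤-trans (ℕP.+-monoʳ-< (q ℕ.^ g 0) rest) (ℕP.≤-trans dbl (ℕP.^-monoʳ-≤ q {{ℕ.>-nonZero (ℕP.≤-trans (s≤s z≤n) q≥2)}} (h1 0 (s≤s z≤n) e0)))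
    where
    rest : sumToℕ l (λ i → if P (suc i) then q ℕ.^ g (suc i) else 0) < q ℕ.^ g 0
    rest = sum-of-distinct-powers< q q≥2 l (λ i → P (suc i)) (λ i → g (suc i)) (g 0) (λ i i<l ei → h2 0 (suc i) (s≤s z≤n) (s≤s i<l) e0 ei) (λ i i' lt lt' → h2 (suc i) (suc i') (s≤s lt) (s≤s lt'))
    dbl : q ℕ.^ g 0 ℕ.+ q ℕ.^ g 0 ≤ q ℕ.^ suc (g 0)
    dbl = subst (_≤ q ℕ.^ suc (g 0)) (lem (q ℕ.^ g 0)) (ℕP.*-monoˡ-≤ (q ℕ.^ g 0) q≥2)
      where
      lem : ∀ x → 2 ℕ.* x ≡ x ℕ.+ x
      lem = NS.solve-∀

  divisorSum : ℕ → (ℕ → ℤ) → ℤ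
  divisorSum N f = sumTo (suc N) (λ j → when (does (j ∣? N)) (f j))

  divisorSum-cong : ∀ N (f g : ℕ → ℤ) → (∀ j → j ∣ N → f j ≡ g j) → divisorSum N f ≡ divisorSum N g
  divisorSum-cong N f g h = sumTo-cong (suc N) pt
    where
    pt : ∀ j → j < suc N → when (does (j ∣? N)) (f j) ≡ when (does (j ∣? N)) (g j)
    pt j _ with j ∣? N
    ... | yes d = h j d
    ... | no _ = refl

  divisorSum-* : ∀ N (f : ℕ → ℤ) c → divisorSum N (λ j → f j * c) ≡ divisorSum N f * c
  divisorSum-* N f c = trans (sumTo-cong (suc N) (λ j _ → trans (sym (when* (does (j ∣? N)) (f j) c)) (ℤP.*-comm _ c)))
    (trans (sumTo-* (suc N) c _) (ℤP.*-comm c _))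

  divisorSum-+ : ∀ N (f g : ℕ → ℤ) → divisorSum N (λ j → f j + g j) ≡ divisorSum N f + divisorSum N g
  divisorSum-+ N f g = trans (sumTo-cong (suc N) (λ j _ → when+ (does (j ∣? N)) (f j) (g j))) (sumTo-+ (suc N) _ _)
    where
    when+ : ∀ b x y → when b (x + y) ≡ when b x + when b y
    when+ true x y = refl
    when+ false x y = refl

  divisorSum-zero : ∀ N (f : ℕ → ℤ) → (∀ j → j ∣ N → f j ≡ + 0) → divisorSum N f ≡ + 0
  divisorSum-zero N f h = trans (divisorSum-cong N f (λ _ → + 0) h) (sumTo-zero (suc N) (λ j _ → when-0 (does (j ∣? N))))

  divisorSum-only1 : ∀ N (f : ℕ → ℤ) → 1 ≤ N → (∀ j → j ∣ N → j ≢ 1 → f j ≡ + 0) → divisorSum N f ≡ f 1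
  divisorSum-only1 (suc N') f _ h = trans (sumTo-suc (suc N') _) (trans (ℤP.+-identityˡ _) (trans (sumTo-suc N' _)
    (trans (cong₂ _+_ (cong (λ b → when b (f 1)) (dec-true (1 ∣? suc N') (1∣ _))) (sumTo-zero N' pt)) (ℤP.+-identityʳ _))))
    where
    pt : ∀ i → i < N' → when (does (suc (suc i) ∣? suc N')) (f (suc (suc i))) ≡ + 0
    pt i _ = when-does (suc (suc i) ∣? suc N') _ (λ dv → h (suc (suc i)) dv (λ ()))

  divisorSum-split1 : ∀ N (f : ℕ → ℤ) → 1 ≤ N → divisorSum N f ≡ f 1 + sumTo (N ∸ 1) (λ i → when (does (suc (suc i) ∣? N)) (f (suc (suc i))))
  divisorSum-split1 (suc N') f _ = trans (sumTo-suc (suc N') _) (trans (ℤP.+-identityˡ _) (trans (sumTo-suc N' _)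
    (cong (λ b → when b (f 1) + sumTo N' (λ i → when (does (suc (suc i) ∣? suc N')) (f (suc (suc i))))) (dec-true (1 ∣? suc N') (1∣ _)))))

  divisorSum-1 : ∀ f → divisorSum 1 f ≡ f 1
  divisorSum-1 f = trans (sumTo-suc 1 _) (trans (cong (λ z → + 0 + z) (trans (sumTo-suc 0 _) (cong (λ z → f 1 + z) (sumTo-0 _)))) (trans (ℤP.+-identityˡ _) (ℤP.+-identityʳ _)))

  divisorSum-2 : ∀ f → divisorSum 2 f ≡ f 1 + f 2
  divisorSum-2 f = trans (sumTo-suc 2 _) (trans (cong (λ z → + 0 + z) (trans (sumTo-suc 1 _) (cong (λ z → f 1 + z) (trans (sumTo-suc 0 _) (cong (λ z → f 2 + z) (sumTo-0 _)))))) (trans (ℤP.+-identityˡ _) (cong (λ z → f 1 + z) (ℤP.+-identityʳ _))))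

  divisorSum-N≡1 : ∀ N → N ≡ 1 → (F : ℕ → ℕ → ℤ) → divisorSum N (F N) ≡ F 1 1
  divisorSum-N≡1 .1 refl F = divisorSum-1 (F 1)

  divisorSum-N≡2 : ∀ N → N ≡ 2 → (F : ℕ → ℕ → ℤ) → divisorSum N (F N) ≡ F 2 1 + F 2 2
  divisorSum-N≡2 .2 refl F = divisorSum-2 (F 2)

  divisorSum-extend : ∀ M N → 1 ≤ M → M ≤ N → (g : ℕ → ℤ) →
    sumTo (suc N) (λ j → when (does (j ∣? M)) (g j)) ≡ sumTo (suc M) (λ j → when (does (j ∣? M)) (g j))
  divisorSum-extend M N M≥1 le g = trans (cong (λ z → sumTo (suc z) _) (sym (ℕP.m+[n∸m]≡n le)))
    (sumTo-truncate M (N ∸ M) _ (λ i → cong (λ b → when b (g (suc M ℕ.+ i))) (dec-false (suc M ℕ.+ i ∣? M) (λ d → ℕP.<⇒≱ (s≤s (ℕP.m≤m+n M i)) (∣⇒≤ {{ℕ.>-nonZero M≥1}} d)))))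

  -- Parity and signs

  odd : ℕ → Bool
  odd zero = false
  odd (suc zero) = true
  odd (suc (suc n)) = odd n

  half : ℕ → ℕ
  half zero = zero
  half (suc zero) = zero
  half (suc (suc n)) = suc (half n)

  odd-suc : ∀ n → odd (suc n) ≡ not (odd n)
  odd-suc zero = refl
  odd-suc (suc zero) = refl
  odd-suc (suc (suc n)) = odd-suc n

  half*2+bit : ∀ s → s ≡ half s ℕ.* 2 ℕ.+ bit (odd s)
  half*2+bit zero = refl
  half*2+bit (suc zero) = refl
  half*2+bit (suc (suc s)) = trans (cong (λ z → suc (suc z)) (half*2+bit s)) (lem (half s) (bit (odd s)))
    where
    lem : ∀ h b → suc (suc (h ℕ.* 2 ℕ.+ b)) ≡ suc h ℕ.* 2 ℕ.+ b
    lem = NS.solve-∀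

  even⇒half*2 : ∀ s → odd s ≡ false → s ≡ half s ℕ.* 2
  even⇒half*2 s even = trans (half*2+bit s) (trans (cong (λ b → half s ℕ.* 2 ℕ.+ bit b) even) (ℕP.+-identityʳ _))

  odd-+ : ∀ a b → odd (a ℕ.+ b) ≡ odd a xor odd b
  odd-+ zero b = refl
  odd-+ (suc a) b = begin
    odd (suc a ℕ.+ b)        ≡⟨ odd-suc (a ℕ.+ b) ⟩
    not (odd (a ℕ.+ b))      ≡⟨ cong not (odd-+ a b) ⟩
    not (odd a xor odd b)    ≡⟨ BoolP.not-distribˡ-xor (odd a) (odd b) ⟩
    not (odd a) xor odd b    ≡⟨ cong (_xor odd b) (sym (odd-suc a)) ⟩
    odd (suc a) xor odd b    ∎
    where open ≡-Reasoning

  odd-* : ∀ a b → odd (a ℕ.* b) ≡ odd a ∧ odd b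
  odd-* zero b = refl
  odd-* (suc a) b = trans (odd-+ b (a ℕ.* b)) (trans (cong (odd b xor_) (odd-* a b)) (trans (lem (odd a) (odd b)) (cong (_∧ odd b) (sym (odd-suc a)))))
    where
    lem : ∀ x y → y xor (x ∧ y) ≡ not x ∧ y
    lem true true = refl
    lem true false = refl
    lem false y = BoolP.xor-identityʳ y

  odd-∸ : ∀ a b → b ≤ a → odd (a ∸ b) ≡ odd a xor odd b
  odd-∸ a b b≤a = begin
    odd (a ∸ b)                          ≡⟨ sym (BoolP.xor-identityʳ _) ⟩
    odd (a ∸ b) xor false                ≡⟨ cong (odd (a ∸ b) xor_) (sym (BoolP.xor-same (odd b))) ⟩
    odd (a ∸ b) xor (odd b xor odd b)    ≡⟨ sym (BoolP.xor-assoc (odd (a ∸ b)) (odd b) (odd b)) ⟩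
    (odd (a ∸ b) xor odd b) xor odd b    ≡⟨ cong (_xor odd b) (sym (odd-+ (a ∸ b) b)) ⟩
    odd (a ∸ b ℕ.+ b) xor odd b          ≡⟨ cong (λ m → odd m xor odd b) (ℕP.m∸n+n≡m b≤a) ⟩
    odd a xor odd b                      ∎
    where open ≡-Reasoning

  odd-∸1 : ∀ t → 1 ≤ t → odd (t ∸ 1) ≡ not (odd t)
  odd-∸1 (suc t) _ = trans (sym (BoolP.not-involutive (odd t))) (cong not (sym (odd-suc t)))

  odd-∸2 : ∀ k → 2 ≤ k → odd (k ∸ 2) ≡ odd k
  odd-∸2 (suc zero) (s≤s ())
  odd-∸2 (suc (suc k)) _ = refl

  odd-double : ∀ x → odd (x ℕ.+ x) ≡ false
  odd-double zero = refl
  odd-double (suc x) = trans (cong odd (cong suc (ℕP.+-suc x x))) (odd-double x)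

  half-double : ∀ x → half (x ℕ.+ x) ≡ x
  half-double zero = refl
  half-double (suc x) = trans (cong half (cong suc (ℕP.+-suc x x))) (cong suc (half-double x))

  half< : ∀ n → 1 ≤ n → half n < n
  half< (suc zero) _ = s≤s z≤n
  half< (suc (suc n)) _ = s≤s (s≤s (half≤ n))
    where
    half≤ : ∀ n → half n ≤ n
    half≤ zero = z≤n
    half≤ (suc zero) = z≤n
    half≤ (suc (suc n)) = s≤s (ℕP.≤-trans (half≤ n) (ℕP.n≤1+n n))

  even-∣ : ∀ t n → odd t ≡ false → t ∣ n → odd n ≡ false
  even-∣ t n even (divides c refl) = trans (odd-* c t) (trans (cong (odd c ∧_) even) (BoolP.∧-zeroʳ (odd c)))

  sgn : Bool → ℤ
  sgn true = - + 1
  sgn false = + 1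

  neg1^-sgn : ∀ e → neg1^ e ≡ sgn (odd e)
  neg1^-sgn zero = refl
  neg1^-sgn (suc e) = trans (cong -_ (neg1^-sgn e)) (trans (neg-sgn (odd e)) (cong sgn (sym (odd-suc e))))
    where
    neg-sgn : ∀ b → - sgn b ≡ sgn (not b)
    neg-sgn true = refl
    neg-sgn false = refl

  sgn-sq : ∀ b → sgn b * sgn b ≡ + 1
  sgn-sq true = refl
  sgn-sq false = refl

  neg1^≢0 : ∀ e → neg1^ e ≢ + 0
  neg1^≢0 e eq = sgn≢0 (odd e) (trans (sym (neg1^-sgn e)) eq)
    where
    sgn≢0 : ∀ b → sgn b ≢ + 0
    sgn≢0 true ()
    sgn≢0 false ()

  Sign : ℤ → Set
  Sign c = c ≡ + 1 ⊎ (c ≡ - + 1 ⊎ c ≡ + 0)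

  Sign-sgn : ∀ b → Sign (sgn b)
  Sign-sgn true = inj₂ (inj₁ refl)
  Sign-sgn false = inj₁ refl

  Sign-neg1^ : ∀ e → Sign (neg1^ e)
  Sign-neg1^ e = subst Sign (sym (neg1^-sgn e)) (Sign-sgn (odd e))

  Sign-μ : ∀ m → Sign (μ m)
  Sign-μ m with squarefree m
  ... | true = Sign-neg1^ (ω m)
  ... | false = inj₂ (inj₂ refl)

  Sign-* : ∀ {a b} → Sign a → Sign b → Sign (a * b)
  Sign-* (inj₁ refl) hb = subst Sign (sym (ℤP.*-identityˡ _)) hb
  Sign-* (inj₂ (inj₁ refl)) (inj₁ refl) = inj₂ (inj₁ refl)
  Sign-* (inj₂ (inj₁ refl)) (inj₂ (inj₁ refl)) = inj₁ refl
  Sign-* (inj₂ (inj₁ refl)) (inj₂ (inj₂ refl)) = inj₂ (inj₂ refl)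
  Sign-* (inj₂ (inj₂ refl)) hb = inj₂ (inj₂ refl)

  Sign-bound : ∀ {c} → Sign c → ∀ y → + 0 ℤ.≤ y → - y ℤ.≤ c * y
  Sign-bound (inj₁ refl) y h = ℤP.≤-trans (ℤP.neg-mono-≤ h) (ℤP.≤-trans h (ℤP.≤-reflexive (sym (ℤP.*-identityˡ y))))
  Sign-bound (inj₂ (inj₁ refl)) y h = ℤP.≤-reflexive (sym (ℤP.-1*i≡-i y))
  Sign-bound (inj₂ (inj₂ refl)) y h = ℤP.≤-trans (ℤP.neg-mono-≤ h) (ℤP.≤-reflexive (sym (ℤP.*-zeroˡ y)))

  *-pos : ∀ {a b} → + 0 ℤ.< a → + 0 ℤ.< b → + 0 ℤ.< a * b
  *-pos {+ suc a} {+ suc b} _ _ = ℤ.+<+ (s≤s z≤n)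
  *-pos {+ zero} {_} (ℤ.+<+ ()) _
  *-pos {+ suc a} {+ zero} _ (ℤ.+<+ ())

  *-cancelʳ-pos : ∀ a {b} → + 0 ℤ.< b → + 0 ℤ.< a * b → + 0 ℤ.< a
  *-cancelʳ-pos a {+ zero} (ℤ.+<+ ()) h
  *-cancelʳ-pos a {+ suc b} _ h = ℤP.*-cancelʳ-<-nonNeg (+ suc b) (subst (ℤ._< a * + suc b) (sym (ℤP.*-zeroˡ (+ suc b))) h)

  pow-pos : ∀ q e → (+ q) ℤ.^ e ≡ + (q ℕ.^ e)
  pow-pos q zero = refl
  pow-pos q (suc e) = trans (cong (+ q *_) (pow-pos q e)) (sym (ℤP.pos-* q (q ℕ.^ e)))

  q^e-1>0 : ∀ q e → 2 ≤ q → 1 ≤ e → + 0 ℤ.< (+ q) ℤ.^ e + - + 1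
  q^e-1>0 q e q≥2 e≥1 = subst (λ z → + 0 ℤ.< z + - + 1) (sym (pow-pos q e)) (lem (q ℕ.^ e) big)
    where
    big : 2 ≤ q ℕ.^ e
    big = ℕP.≤-trans q≥2 (subst (_≤ q ℕ.^ e) (ℕP.*-identityʳ q) (ℕP.^-monoʳ-≤ q {{ℕ.>-nonZero (ℕP.≤-trans (s≤s z≤n) q≥2)}} e≥1))
    lem : ∀ z → 2 ≤ z → + 0 ℤ.< + z + - + 1
    lem (suc zero) (s≤s ())
    lem (suc (suc z)) _ = ℤ.+<+ (s≤s z≤n)

  -- The Möbius function

  noSquareDivisorIn : ℕ → List ℕ → Bool
  noSquareDivisorIn n xs = foldr (λ p b → not (does ((p ℕ.* p) ∣? n)) ∧ b) true xs

  noSquareDivisorIn⇒ : ∀ n (f g : ℕ → ℕ) l → noSquareDivisorIn n (map f (applyUpTo g l)) ≡ true → ∀ i → i < l → ¬ (f (g i) ℕ.* f (g i) ∣ n)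
  noSquareDivisorIn⇒ n f g (suc l) h zero _ dv with (f (g 0) ℕ.* f (g 0)) ∣? n
  ... | yes _ = contradiction h λ ()
  ... | no ¬d = ¬d dv
  noSquareDivisorIn⇒ n f g (suc l) h (suc i) (s≤s i<l) dv with (f (g 0) ℕ.* f (g 0)) ∣? n
  ... | yes _ = contradiction h λ ()
  ... | no _ = noSquareDivisorIn⇒ n f (λ i → g (suc i)) l h i i<l dv

  ⇒noSquareDivisorIn : ∀ n (f g : ℕ → ℕ) l → (∀ i → i < l → ¬ (f (g i) ℕ.* f (g i) ∣ n)) → noSquareDivisorIn n (map f (applyUpTo g l)) ≡ true
  ⇒noSquareDivisorIn n f g zero h = refl
  ⇒noSquareDivisorIn n f g (suc l) h with (f (g 0) ℕ.* f (g 0)) ∣? n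
  ... | yes d = ⊥-elim (h 0 (s≤s z≤n) d)
  ... | no _ = ⇒noSquareDivisorIn n f (λ i → g (suc i)) l (λ i i<l → h (suc i) (s≤s i<l))

  SquareFree : ℕ → Set
  SquareFree n = ∀ x → 2 ≤ x → ¬ (x ℕ.* x ∣ n)

  squarefree⇒SquareFree : ∀ n → 1 ≤ n → squarefree n ≡ true → SquareFree n
  squarefree⇒SquareFree (suc n) _ h (suc zero) (s≤s ()) dv
  squarefree⇒SquareFree (suc n) _ h (suc (suc x)) _ dv = noSquareDivisorIn⇒ (suc n) (λ i → suc (suc i)) (λ i → i) n h x x<n dv
    where
    le : suc (suc x) ≤ suc n
    le = ℕP.≤-trans (ℕP.m≤m*n (suc (suc x)) (suc (suc x))) (∣⇒≤ dv)
    x<n : x < n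
    x<n = ℕP.≤-pred le

  SquareFree⇒squarefree : ∀ n → SquareFree n → squarefree n ≡ true
  SquareFree⇒squarefree n h = ⇒noSquareDivisorIn n (λ i → suc (suc i)) (λ i → i) (n ∸ 1) (λ i _ → h (suc (suc i)) (s≤s (s≤s z≤n)))

  ¬SquareFree⇒squarefree≡false : ∀ n' → ¬ SquareFree (suc n') → squarefree (suc n') ≡ false
  ¬SquareFree⇒squarefree≡false n' ¬s with squarefree (suc n') in eq
  ... | true = ⊥-elim (¬s (squarefree⇒SquareFree (suc n') (s≤s z≤n) eq))
  ... | false = refl

  prime≥2 : ∀ {p} → Prime p → 2 ≤ p
  prime≥2 {p} pp = ℕ.nonTrivial⇒n>1 p {{prime⇒nonTrivial pp}}

  prime≢1 : ∀ {p} → Prime p → p ≢ 1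
  prime≢1 pp refl with prime≥2 pp
  ... | s≤s ()

  ¬∣⇒coprime : ∀ {p m} → Prime p → ¬ p ∣ m → Coprime m p
  ¬∣⇒coprime {p} {m} pp ¬d {i} (i∣m , i∣p) with prime⇒irreducible pp i∣p
  ... | inj₁ i≡1 = i≡1
  ... | inj₂ refl = ⊥-elim (¬d i∣m)

  primeFactor : ∀ N → 2 ≤ N → Σ ℕ λ p → Prime p × p ∣ N
  primeFactor (suc zero) (s≤s ())
  primeFactor N@(suc (suc _)) _ with factorise N
  ... | record { factors = [] ; isFactorisation = () }
  ... | record { factors = p ∷ fs ; isFactorisation = eq ; factorsPrime = pp ∷ _ } =
    p , pp , divides (Data.Nat.ListAction.product fs) (trans eq (ℕP.*-comm p _))
    where import Data.Nat.ListAction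

  primePower≥2 : ∀ q → IsPrimePower q → 2 ≤ q
  primePower≥2 q (p , suc e , pp , _ , refl) = ℕP.≤-trans (prime≥2 pp) (ℕP.m≤m*n p (p ℕ.^ e) {{ℕP.m^n≢0 p e {{ℕ.>-nonZero (ℕP.≤-trans (s≤s z≤n) (prime≥2 pp))}}}})
  primePower≥2 q (p , zero , pp , () , _)

  SquareFree-*-prime : ∀ {p j} → Prime p → ¬ p ∣ j → SquareFree j → SquareFree (j ℕ.* p)
  SquareFree-*-prime {suc p'} {j} pp ¬pj sj x 2≤x dv with suc p' ∣? x
  ... | yes p∣x = ¬pj (*-cancelʳ-∣ (suc p') (∣-trans (*-pres-∣ p∣x p∣x) dv))
  ... | no ¬p∣x = sj x 2≤x (coprime-divisor cop (subst (λ z → x ℕ.* x ∣ z) (ℕP.*-comm j (suc p')) dv))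
    where
    ¬p∣xx : ¬ (suc p' ∣ x ℕ.* x)
    ¬p∣xx d with euclidsLemma x x pp d
    ... | inj₁ a = ¬p∣x a
    ... | inj₂ a = ¬p∣x a
    cop : Coprime (x ℕ.* x) (suc p')
    cop = ¬∣⇒coprime pp ¬p∣xx

  SquareFree-*⇒SquareFree : ∀ {p j} → SquareFree (j ℕ.* p) → SquareFree j
  SquareFree-*⇒SquareFree {p} s x 2≤x dv = s x 2≤x (∣-trans dv (m∣m*n p))

  ¬SquareFree-*-prime∣ : ∀ {p j} → Prime p → p ∣ j → ¬ SquareFree (j ℕ.* p)
  ¬SquareFree-*-prime∣ {p} pp d s = s p (prime≥2 pp) (*-monoˡ-∣ p d)

  isPrimeDivisor : ℕ → ℕ → Bool
  isPrimeDivisor n y = does (prime? y) ∧ does (y ∣? n)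

  ω-eq : ∀ n → ω n ≡ sumToℕ (n ∸ 1) (λ i → bit (isPrimeDivisor n (suc (suc i))))
  ω-eq n = length-filter (λ p → prime? p ×-dec p ∣? n) (λ i → suc (suc i)) (λ i → i) (n ∸ 1)

  ≡ᵇ-sound : ∀ a b → (a ≡ᵇ b) ≡ true → a ≡ b
  ≡ᵇ-sound zero zero _ = refl
  ≡ᵇ-sound zero (suc b) ()
  ≡ᵇ-sound (suc a) zero ()
  ≡ᵇ-sound (suc a) (suc b) e = cong suc (≡ᵇ-sound a b e)

  ≡ᵇ-refl : ∀ a → (a ≡ᵇ a) ≡ true
  ≡ᵇ-refl zero = refl
  ≡ᵇ-refl (suc a) = ≡ᵇ-refl a

  isPrimeDivisor-*-prime : ∀ {p j} → Prime p → ¬ p ∣ j → ∀ y →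
    bit (does (prime? y) ∧ does (y ∣? j ℕ.* p)) ≡ bit (does (prime? y) ∧ does (y ∣? j)) ℕ.+ bit (y ≡ᵇ p)
  isPrimeDivisor-*-prime {p} {j} pp ¬pj y with prime? y | y ≡ᵇ p in eqb
  ... | no ¬py | true = ⊥-elim (¬py (subst Prime (sym (≡ᵇ-sound y p eqb)) pp))
  ... | no ¬py | false = refl
  ... | yes py | true with refl ← ≡ᵇ-sound y p eqb =
    trans (cong bit (dec-true (y ∣? j ℕ.* y) (n∣m*n j))) (cong (λ b → bit b ℕ.+ 1) (sym (dec-false (y ∣? j) ¬pj)))
  ... | yes py | false with y ∣? j
  ...   | yes y∣j = cong bit (dec-true (y ∣? j ℕ.* p) (∣-trans y∣j (m∣m*n p)))
  ...   | no ¬y∣j = cong bit (dec-false (y ∣? j ℕ.* p) λ d → excluded (euclidsLemma j p py d))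
    where
    excluded : y ∣ j ⊎ y ∣ p → _
    excluded (inj₁ a) = ¬y∣j a
    excluded (inj₂ a) with prime⇒irreducible pp a
    ... | inj₁ refl = prime≢1 py refl
    ... | inj₂ refl = contradiction (trans (sym (≡ᵇ-refl y)) eqb) λ ()

  ω-sum-extend : ∀ j → 1 ≤ j → ∀ M → j ∸ 1 ≤ M → sumToℕ M (λ i → bit (isPrimeDivisor j (suc (suc i)))) ≡ sumToℕ (j ∸ 1) (λ i → bit (isPrimeDivisor j (suc (suc i))))
  ω-sum-extend j j≥1 M le = trans (cong (λ z → sumToℕ z _) (sym (ℕP.m+[n∸m]≡n le)))
    (trans (sumToℕ-split (j ∸ 1) (M ∸ (j ∸ 1)) _) (trans (cong (λ z → sumToℕ (j ∸ 1) _ ℕ.+ z) (sumToℕ-zero (M ∸ (j ∸ 1)) {λ i → bit (isPrimeDivisor j (suc (suc (j ∸ 1 ℕ.+ i))))} λ i _ → cong bit (trans (cong (does (prime? (suc (suc (j ∸ 1 ℕ.+ i)))) ∧_) (dec-false (suc (suc (j ∸ 1 ℕ.+ i)) ∣? j) (nd i))) (BoolP.∧-zeroʳ _)))) (ℕP.+-identityʳ _)))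
    where
    nd : ∀ i → ¬ (suc (suc (j ∸ 1 ℕ.+ i)) ∣ j)
    nd i d = ℕP.<⇒≱ lt (∣⇒≤ {{ℕ.>-nonZero j≥1}} d)
      where
      lt : j < suc (suc (j ∸ 1 ℕ.+ i))
      lt = s≤s (ℕP.≤-trans (ℕP.≤-reflexive (sym (ℕP.m+[n∸m]≡n j≥1))) (ℕP.m≤m+n (suc (j ∸ 1)) i))

  ω-*-prime : ∀ {p j} → Prime p → ¬ p ∣ j → 1 ≤ j → ω (j ℕ.* p) ≡ suc (ω j)
  ω-*-prime {suc (suc c)} {j} pp ¬pj j≥1 = begin
      ω (j ℕ.* p)
    ≡⟨ ω-eq (j ℕ.* p) ⟩
      sumToℕ (j ℕ.* p ∸ 1) (λ i → bit (isPrimeDivisor (j ℕ.* p) (suc (suc i))))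
    ≡⟨ sumToℕ-cong (j ℕ.* p ∸ 1) (λ i _ → isPrimeDivisor-*-prime pp ¬pj (suc (suc i))) ⟩
      sumToℕ (j ℕ.* p ∸ 1) (λ i → bit (isPrimeDivisor j (suc (suc i))) ℕ.+ bit (i ≡ᵇ c))
    ≡⟨ sumToℕ-+ (j ℕ.* p ∸ 1) _ _ ⟩
      sumToℕ (j ℕ.* p ∸ 1) (λ i → bit (isPrimeDivisor j (suc (suc i)))) ℕ.+ sumToℕ (j ℕ.* p ∸ 1) (λ i → bit (i ≡ᵇ c))
    ≡⟨ cong₂ ℕ._+_ (ω-sum-extend j j≥1 (j ℕ.* p ∸ 1) le1) (sumToℕ-bit-≡ᵇ (j ℕ.* p ∸ 1) c lt2) ⟩
      sumToℕ (j ∸ 1) (λ i → bit (isPrimeDivisor j (suc (suc i)))) ℕ.+ 1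
    ≡⟨ ℕP.+-comm _ 1 ⟩
      suc (sumToℕ (j ∸ 1) (λ i → bit (isPrimeDivisor j (suc (suc i)))))
    ≡⟨ cong suc (sym (ω-eq j)) ⟩
      suc (ω j) ∎
    where
    open ≡-Reasoning
    p : ℕ
    p = suc (suc c)
    jp≥p : p ≤ j ℕ.* p
    jp≥p = ℕP.m≤n*m p j {{ℕ.>-nonZero j≥1}}
    le1 : j ∸ 1 ≤ j ℕ.* p ∸ 1
    le1 = ℕP.∸-monoˡ-≤ 1 (ℕP.m≤m*n j p)
    lt2 : c < j ℕ.* p ∸ 1
    lt2 = ℕP.∸-monoˡ-≤ 1 jp≥p

  μ-*-prime : ∀ {p j} → Prime p → ¬ p ∣ j → 1 ≤ j → μ (j ℕ.* p) ≡ - μ j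
  μ-*-prime {suc p'} {suc j'} pp ¬pj j≥1 with squarefree (suc j') in eq
  ... | true = trans (cong (λ b → if b then neg1^ (ω (suc j' ℕ.* suc p')) else + 0) (SquareFree⇒squarefree _ (SquareFree-*-prime pp ¬pj (squarefree⇒SquareFree (suc j') j≥1 eq))))
                     (cong neg1^ (ω-*-prime pp ¬pj j≥1))
  ... | false = cong (λ b → if b then neg1^ (ω (suc j' ℕ.* suc p')) else + 0) (¬SquareFree⇒squarefree≡false _ (λ s → ne (SquareFree⇒squarefree (suc j') (SquareFree-*⇒SquareFree {suc p'} s))))
    where
    ne : squarefree (suc j') ≡ true → _
    ne e with trans (sym e) eq
    ... | ()

  μ-*-prime-∣ : ∀ {p j} → Prime p → p ∣ j → 1 ≤ j → μ (j ℕ.* p) ≡ + 0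
  μ-*-prime-∣ {suc p'} {suc j'} pp d j≥1 = cong (λ b → if b then neg1^ (ω (suc j' ℕ.* suc p')) else + 0) (¬SquareFree⇒squarefree≡false _ (¬SquareFree-*-prime∣ pp d))

  divisor≥1 : ∀ {j N} → 1 ≤ N → j ∣ N → 1 ≤ j
  divisor≥1 {zero} N≥1 d with 0∣⇒≡0 d
  ... | refl = N≥1
  divisor≥1 {suc j} _ _ = s≤s z≤n

  1∨2∨≥3 : ∀ N → 1 ≤ N → N ≡ 1 ⊎ (N ≡ 2 ⊎ 3 ≤ N)
  1∨2∨≥3 (suc zero) _ = inj₁ refl
  1∨2∨≥3 (suc (suc zero)) _ = inj₂ (inj₁ refl)
  1∨2∨≥3 (suc (suc (suc N))) _ = inj₂ (inj₂ (s≤s (s≤s (s≤s z≤n))))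

  ≢1⇒>1 : ∀ j → 1 ≤ j → j ≢ 1 → 1 < j
  ≢1⇒>1 (suc zero) _ ne = ⊥-elim (ne refl)
  ≢1⇒>1 (suc (suc j)) _ _ = s≤s (s≤s z≤n)

  cofactor : ℕ → ℕ → ℕ
  cofactor n m = n ÷ m

  cofactor-* : ∀ t m' → cofactor (t ℕ.* suc m') (suc m') ≡ t
  cofactor-* t m' = m*n/n≡m t (suc m')

  cofactor-*ʳ : ∀ t j → 1 ≤ j → cofactor (t ℕ.* j) j ≡ t
  cofactor-*ʳ t (suc j') _ = cofactor-* t j'

  -- Split the divisors of M p by whether p divides them: μ (j p) = - μ j when p ∤ j and 0 otherwise.
  divisorSum-μ-*-prime : ∀ M p' → Prime (suc p') → 1 ≤ M → divisorSum (M ℕ.* suc p') μ ≡ + 0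
  divisorSum-μ-*-prime M p' pp M≥1 = begin
      sumTo (suc N) (λ j → when (does (j ∣? N)) (μ j))
    ≡⟨ sumTo-cong (suc N) (λ j _ → when-split (does (P ∣? j)) (does (j ∣? N)) (μ j)) ⟩
      sumTo (suc N) (λ j → when (does (P ∣? j)) (when (does (j ∣? N)) (μ j)) + when (not (does (P ∣? j))) (when (does (j ∣? N)) (μ j)))
    ≡⟨ sumTo-+ (suc N) _ _ ⟩
      sumTo (suc N) (λ j → when (does (P ∣? j)) (when (does (j ∣? N)) (μ j))) + sumTo (suc N) (λ j → when (not (does (P ∣? j))) (when (does (j ∣? N)) (μ j)))
    ≡⟨ cong₂ _+_ stepX stepY ⟩
      - sumTo (suc M) B + sumTo (suc M) B
    ≡⟨ ℤP.+-inverseˡ (sumTo (suc M) B) ⟩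
      + 0 ∎
    where
    open ≡-Reasoning
    P N : ℕ
    P = suc p'
    N = M ℕ.* P
    B : ℕ → ℤ
    B j = when (not (does (P ∣? j))) (when (does (j ∣? M)) (μ j))
    ptX : ∀ j → when (does (j ∣? M)) (μ (j ℕ.* P)) ≡ - B j
    ptX j with j ∣? M
    ... | no _ = sym (trans (cong -_ (when-0 (not (does (P ∣? j))))) refl)
    ... | yes d with P ∣? j in eqd
    ...   | yes pj = trans (μ-*-prime-∣ pp pj (divisor≥1 M≥1 d)) (sym (cong (λ b → - when (not b) (μ j)) (dec-true (P ∣? j) pj)))
    ...   | no ¬pj = trans (μ-*-prime pp ¬pj (divisor≥1 M≥1 d)) (sym (cong (λ b → - when (not b) (μ j)) (dec-false (P ∣? j) ¬pj)))
    stepX : sumTo (suc N) (λ j → when (does (P ∣? j)) (when (does (j ∣? N)) (μ j))) ≡ - sumTo (suc M) B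
    stepX = trans (sumTo-multiples p' M (λ j → when (does (j ∣? N)) (μ j)))
      (trans (sumTo-cong (suc M) (λ j _ → trans (cong (λ b → when b (μ (j ℕ.* P))) (does-iff (j ℕ.* P ∣? N) (j ∣? M) (*-cancelʳ-∣ P) (*-monoˡ-∣ P))) (ptX j)))
      (sumTo-neg (suc M) B))
    ptY : ∀ j → when (not (does (P ∣? j))) (when (does (j ∣? N)) (μ j)) ≡ B j
    ptY j = when-cond (does (P ∣? j)) (λ e → cong (λ b → when b (μ j)) (does-iff (j ∣? N) (j ∣? M)
           (λ d → coprime-divisor (¬∣⇒coprime pp (¬pj e)) (subst (j ∣_) (ℕP.*-comm M P) d)) (λ d → ∣-trans d (m∣m*n P))))
      where
      ¬pj : does (P ∣? j) ≡ false → ¬ P ∣ j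
      ¬pj e pj with trans (sym (dec-true (P ∣? j) pj)) e
      ... | ()
    stepY : sumTo (suc N) (λ j → when (not (does (P ∣? j))) (when (does (j ∣? N)) (μ j))) ≡ sumTo (suc M) B
    stepY = trans (sumTo-cong (suc N) (λ j _ → trans (ptY j) (when-swap (not (does (P ∣? j))) (does (j ∣? M)) (μ j))))
      (trans (divisorSum-extend M N M≥1 (ℕP.m≤m*n M P) (λ j → when (not (does (P ∣? j))) (μ j))) (sumTo-cong (suc M) (λ j _ → when-swap (does (j ∣? M)) (not (does (P ∣? j))) (μ j))))

  divisorSum-μ : ∀ N → 2 ≤ N → divisorSum N μ ≡ + 0
  divisorSum-μ N N≥2 with primeFactor N N≥2
  ... | suc p' , pp , divides M refl = divisorSum-μ-*-prime M p' pp (M≥1 M N≥2)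
    where
    M≥1 : ∀ M → 2 ≤ M ℕ.* suc p' → 1 ≤ M
    M≥1 zero ()
    M≥1 (suc M) _ = s≤s z≤n
  ... | zero , pp , _ = contradiction (prime≥2 pp) λ ()

  odd-cofactor : ∀ N j → odd N ≡ true → j ∣ N → 1 ≤ N → odd (cofactor N j) ≡ true
  odd-cofactor N j eo (divides t refl) N≥1 with odd t in et | cofactor-*ʳ t j (divisor≥1 N≥1 (divides t refl))
  ... | true | e = trans (cong odd e) et
  ... | false | e = contradiction (trans (sym (even-∣ t (t ℕ.* j) et (divides j (ℕP.*-comm t j)))) eo) λ ()

  -- For N = 2M the divisors j of N with N/j even are exactly the divisors of M.
  divisorSum-μ-evenCofactor-*2 : ∀ M → 2 ≤ M → divisorSum (M ℕ.* 2) (λ j → when (not (odd (cofactor (M ℕ.* 2) j))) (μ j)) ≡ + 0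
  divisorSum-μ-evenCofactor-*2 M M≥2 = trans (sumTo-cong (suc N) termwise) (trans (divisorSum-extend M N M≥1 (ℕP.m≤m*n M 2) μ) (divisorSum-μ M M≥2))
    where
    N : ℕ
    N = M ℕ.* 2
    M≥1 : 1 ≤ M
    M≥1 = ℕP.≤-trans (s≤s z≤n) M≥2
    ∣M⇒evenCofactor : ∀ j → j ∣ M → odd (cofactor N j) ≡ false
    ∣M⇒evenCofactor j (divides u eq) = trans (cong odd (trans (cong (λ z → cofactor z j) (e2 eq)) (cofactor-*ʳ (u ℕ.* 2) j (divisor≥1 M≥1 (divides u eq))))) (trans (odd-* u 2) (BoolP.∧-zeroʳ (odd u)))
      where
      e2 : M ≡ u ℕ.* j → N ≡ u ℕ.* 2 ℕ.* j
      e2 refl = lem u j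
        where
        lem : ∀ u j → u ℕ.* j ℕ.* 2 ≡ u ℕ.* 2 ℕ.* j
        lem = NS.solve-∀
    evenCofactor⇒∣M : ∀ j → j ∣ N → odd (cofactor N j) ≡ false → j ∣ M
    evenCofactor⇒∣M j (divides t eq) et = divides (half t) (ℕP.*-cancelʳ-≡ M (half t ℕ.* j) 2 (trans eq (trans (cong (ℕ._* j) ht) (lem (half t) j))))
      where
      tN : cofactor N j ≡ t
      tN = trans (cong (λ z → cofactor z j) eq) (cofactor-*ʳ t j (divisor≥1 (ℕP.≤-trans M≥1 (ℕP.m≤m*n M 2)) (divides t eq)))
      ht : t ≡ half t ℕ.* 2
      ht = even⇒half*2 t (trans (cong odd (sym tN)) et)
      lem : ∀ h j → h ℕ.* 2 ℕ.* j ≡ h ℕ.* j ℕ.* 2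
      lem = NS.solve-∀
    termwise : ∀ j → j < suc N → when (does (j ∣? N)) (when (not (odd (cofactor N j))) (μ j)) ≡ when (does (j ∣? M)) (μ j)
    termwise j _ with j ∣? N
    ... | no ¬a = sym (cong (λ b → when b (μ j)) (dec-false (j ∣? M) (λ d → ¬a (∣-trans d (m∣m*n 2)))))
    ... | yes a with odd (cofactor N j) in eo
    ...   | true = sym (cong (λ b → when b (μ j)) (dec-false (j ∣? M) (λ d → contradiction (trans (sym (∣M⇒evenCofactor j d)) eo) λ ())))
    ...   | false = sym (cong (λ b → when b (μ j)) (dec-true (j ∣? M) (evenCofactor⇒∣M j a eo)))

  divisorSum-μ-evenCofactor : ∀ N → 3 ≤ N → divisorSum N (λ j → when (not (odd (cofactor N j))) (μ j)) ≡ + 0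
  divisorSum-μ-evenCofactor N N≥3 with odd N in eo
  ... | true = sumTo-zero (suc N) pt
    where
    pt : ∀ j → j < suc N → when (does (j ∣? N)) (when (not (odd (cofactor N j))) (μ j)) ≡ + 0
    pt j _ with j ∣? N
    ... | no _ = refl
    ... | yes d = cong (λ b → when (not b) (μ j)) (odd-cofactor N j eo d (ℕP.≤-trans (s≤s z≤n) N≥3))
  ... | false = subst (λ z → divisorSum z (λ j → when (not (odd (cofactor z j))) (μ j)) ≡ + 0) (sym nEq) (divisorSum-μ-evenCofactor-*2 (half N) M≥2)
    where
    nEq : N ≡ half N ℕ.* 2
    nEq = even⇒half*2 N eo
    M≥2 : 2 ≤ half N
    M≥2 = lem (half N) (subst (3 ≤_) nEq N≥3)
      where
      lem : ∀ h → 3 ≤ h ℕ.* 2 → 2 ≤ h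
      lem zero ()
      lem (suc zero) (s≤s (s≤s ()))
      lem (suc (suc h)) _ = s≤s (s≤s z≤n)

  -- Division of S by xⁿ - 1

  weight : ℕ → ℕ → ℕ → ℕ → ℤ
  weight k n d m = μ (m ÷ d) * neg1^ (k ℕ.* (n ∸ (n ÷ m)))

  exponent : ℕ → ℕ → ℕ → ℕ
  exponent k n m = ((k ∸ 2) ℕ.* n ℕ.* ((n ÷ m) ∸ 1)) ÷ 2

  term : ℕ → ℕ → ℕ → ℕ → Poly
  term k n d m = weight k n d m ·ₚ X^ (exponent k n m)

  between : ℕ → ℕ → List ℕ
  between n d = filter (λ m → d ∣? m ×-dec m ∣? n) (upTo (suc n))

  -- The exponent is (n/2) · expHalves, i.e. expRem + n · expQuot with expRem ∈ {0, n/2}.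
  expHalves : ℕ → ℕ → ℕ → ℕ
  expHalves k n m = (k ∸ 2) ℕ.* (cofactor n m ∸ 1)

  expQuot : ℕ → ℕ → ℕ → ℕ
  expQuot k n m = half (expHalves k n m)

  expRem : ℕ → ℕ → ℕ → ℕ
  expRem k n m = if odd (expHalves k n m) then half n else 0

  exponent-divMod-suc : ∀ k t m' → 1 ≤ t → exponent k (t ℕ.* suc m') (suc m') ≡ expRem k (t ℕ.* suc m') (suc m') ℕ.+ (t ℕ.* suc m') ℕ.* expQuot k (t ℕ.* suc m') (suc m')
  exponent-divMod-suc k t m' t≥1 = body (odd s) refl
    where
    n s : ℕ
    n = t ℕ.* suc m'
    s = expHalves k n (suc m')
    eqA : (k ∸ 2) ℕ.* n ℕ.* (cofactor n (suc m') ∸ 1) ≡ n ℕ.* s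
    eqA = lem (k ∸ 2) n _
      where
      lem : ∀ a n b → a ℕ.* n ℕ.* b ≡ n ℕ.* (a ℕ.* b)
      lem = NS.solve-∀
    body : ∀ b → odd s ≡ b → exponent k n (suc m') ≡ expRem k n (suc m') ℕ.+ n ℕ.* expQuot k n (suc m')
    body false os = begin
        ((k ∸ 2) ℕ.* n ℕ.* (cofactor n (suc m') ∸ 1)) / 2
      ≡⟨ cong (_/ 2) (trans eqA (cong (n ℕ.*_) (trans (half*2+bit s) (cong (λ b → half s ℕ.* 2 ℕ.+ bit b) os)))) ⟩
        (n ℕ.* (half s ℕ.* 2 ℕ.+ 0)) / 2
      ≡⟨ cong (_/ 2) (lem n (half s)) ⟩
        (n ℕ.* half s) ℕ.* 2 / 2
      ≡⟨ m*n/n≡m (n ℕ.* half s) 2 ⟩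
        n ℕ.* half s
      ≡⟨ cong (λ b → (if b then half n else 0) ℕ.+ n ℕ.* half s) (sym os) ⟩
        expRem k n (suc m') ℕ.+ n ℕ.* expQuot k n (suc m') ∎
      where
      open ≡-Reasoning
      lem : ∀ n h → n ℕ.* (h ℕ.* 2 ℕ.+ 0) ≡ n ℕ.* h ℕ.* 2
      lem = NS.solve-∀
    body true os = begin
        ((k ∸ 2) ℕ.* n ℕ.* (cofactor n (suc m') ∸ 1)) / 2
      ≡⟨ cong (_/ 2) (trans eqA (cong₂ ℕ._*_ nEq (trans (half*2+bit s) (cong (λ b → half s ℕ.* 2 ℕ.+ bit b) os)))) ⟩
        (half n ℕ.* 2 ℕ.* (half s ℕ.* 2 ℕ.+ 1)) / 2
      ≡⟨ cong (_/ 2) (lem (half n) (half s)) ⟩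
        (half n ℕ.+ half n ℕ.* 2 ℕ.* half s) ℕ.* 2 / 2
      ≡⟨ m*n/n≡m _ 2 ⟩
        half n ℕ.+ half n ℕ.* 2 ℕ.* half s
      ≡⟨ cong₂ (λ b x → (if b then half n else 0) ℕ.+ x ℕ.* half s) (sym os) (sym nEq) ⟩
        expRem k n (suc m') ℕ.+ n ℕ.* expQuot k n (suc m') ∎
      where
      open ≡-Reasoning
      lem : ∀ h x → h ℕ.* 2 ℕ.* (x ℕ.* 2 ℕ.+ 1) ≡ (h ℕ.+ h ℕ.* 2 ℕ.* x) ℕ.* 2
      lem = NS.solve-∀
      -- (k - 2)(t - 1) is odd, so t is even and so is its multiple n.
      t1odd : odd (cofactor n (suc m') ∸ 1) ≡ true
      t1odd = lem2 (odd (k ∸ 2)) (odd (cofactor n (suc m') ∸ 1)) (trans (sym (odd-* (k ∸ 2) _)) os)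
        where
        lem2 : ∀ a b → a ∧ b ≡ true → b ≡ true
        lem2 true true _ = refl
        lem2 false b ()
        lem2 true false ()
      teven : odd t ≡ false
      teven = lem3 t t≥1 (trans (cong (λ z → odd (z ∸ 1)) (sym (cofactor-* t m'))) t1odd)
        where
        lem3 : ∀ t → 1 ≤ t → odd (t ∸ 1) ≡ true → odd t ≡ false
        lem3 (suc t) _ o = trans (odd-suc t) (cong not o)
      neven : odd n ≡ false
      neven = even-∣ t n teven (divides (suc m') (ℕP.*-comm t (suc m')))
      nEq : n ≡ half n ℕ.* 2
      nEq = even⇒half*2 n neven

  sumMap-between : ∀ n N d' (F : ℕ → ℤ) → n ≡ N ℕ.* suc d' → sumMap F (between n (suc d')) ≡ divisorSum N (λ j → F (j ℕ.* suc d'))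
  sumMap-between .(N ℕ.* suc d') N d' F refl =
    trans (filter-sum (λ m → suc d' ∣? m ×-dec m ∣? n) F (λ x → x) (suc n))
    (trans (sumTo-cong (suc n) (λ i _ → when-∧ (does (suc d' ∣? i)) (does (i ∣? n)) (F i)))
    (trans (sumTo-multiples d' N (λ i → when (does (i ∣? n)) (F i)))
    (sumTo-cong (suc N) (λ j _ → cong (λ b → when b (F (j ℕ.* suc d'))) (does-iff (j ℕ.* suc d' ∣? n) (j ∣? N) (*-cancelʳ-∣ (suc d')) (*-monoˡ-∣ (suc d')))))))
    where
    n : ℕ
    n = N ℕ.* suc d'

  block : ℕ → ℕ → ℕ → Poly
  block k n m = geometric (expRem k n m) n (expQuot k n m)

  W : ℕ → ℕ → ℕ → Poly
  W k n d = sumₚ (map (λ m → weight k n d m ·ₚ block k n m) (between n d))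

  Rcoeff : ℕ → ℕ → ℕ → ℕ → ℤ
  Rcoeff k n d i = sumMap (λ m → weight k n d m * 𝟙 (i ≡ᵇ expRem k n m)) (between n d)

  aPoly : ℕ → ℕ → ℕ → Poly
  aPoly k n d = W k n d *ₚ (X^ d -ₚ C (+ 1)) +ₚ C (Rcoeff k n d 0)

  coeff-S : ∀ k n d i → coeff (S k n d) i ≡ sumMap (λ m → weight k n d m * 𝟙 (i ≡ᵇ exponent k n m)) (between n d)
  coeff-S k n d i = trans (coeff-sumₚ (term k n d) (between n d) i)
    (sumMap-filter-cong (λ m → d ∣? m ×-dec m ∣? n) (upTo (suc n)) _ _ (λ m _ → trans (coeff-·ₚ (weight k n d m) (X^ (exponent k n m)) i) (cong (weight k n d m *_) (coeff-X^ (exponent k n m) i))))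

  coeff-W : ∀ k n d i → coeff (W k n d) i ≡ sumMap (λ m → weight k n d m * coeff (block k n m) i) (between n d)
  coeff-W k n d i = trans (coeff-sumₚ (λ m → weight k n d m ·ₚ block k n m) (between n d) i)
    (sumMap-filter-cong (λ m → d ∣? m ×-dec m ∣? n) (upTo (suc n)) _ _ (λ m _ → coeff-·ₚ (weight k n d m) (block k n m) i))

  exponent-divMod : ∀ k n m → 1 ≤ n → m ∣ n → exponent k n m ≡ expRem k n m ℕ.+ n ℕ.* expQuot k n m
  exponent-divMod k .(t ℕ.* m) m n≥1 (divides t refl) = go m t n≥1
    where
    go : ∀ m t → 1 ≤ t ℕ.* m → exponent k (t ℕ.* m) m ≡ expRem k (t ℕ.* m) m ℕ.+ (t ℕ.* m) ℕ.* expQuot k (t ℕ.* m) m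
    go zero t h with t ℕ.* 0 | ℕP.*-zeroʳ t
    go zero t () | .0 | refl
    go (suc m') zero ()
    go (suc m') (suc t) h = exponent-divMod-suc k (suc t) m' (s≤s z≤n)

  expRem<n : ∀ k n m → 1 ≤ n → expRem k n m < n
  expRem<n k n m n≥1 with odd (expHalves k n m)
  ... | true = half< n n≥1
  ... | false = n≥1

  W-division : ∀ k n d → 1 ≤ n → ∀ i → shift n (coeff (W k n d)) i + - coeff (W k n d) i ≡ coeff (S k n d) i + - Rcoeff k n d i
  W-division k n d n≥1 i = begin
      shift n (coeff (W k n d)) i + - coeff (W k n d) i
    ≡⟨ cong₂ (λ a b → a + - b) (trans (shift-cong n (coeff-W k n d) i) (trans (shift-sumMap n (λ x m → weight k n d m * coeff (block k n m) x) L i)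
          (sumMap-cong _ _ L (λ m → shift-* n (weight k n d m) (coeff (block k n m)) i)))) (coeff-W k n d i) ⟩
      sumMap (λ m → weight k n d m * shift n (coeff (block k n m)) i) L + - sumMap (λ m → weight k n d m * coeff (block k n m) i) L
    ≡⟨ cong (λ z → sumMap (λ m → weight k n d m * shift n (coeff (block k n m)) i) L + z) (sym (sumMap-neg _ L)) ⟩
      sumMap (λ m → weight k n d m * shift n (coeff (block k n m)) i) L + sumMap (λ m → - (weight k n d m * coeff (block k n m) i)) L
    ≡⟨ sym (sumMap-+ _ _ L) ⟩
      sumMap (λ m → weight k n d m * shift n (coeff (block k n m)) i + - (weight k n d m * coeff (block k n m) i)) L
    ≡⟨ sumMap-filter-cong (λ m → d ∣? m ×-dec m ∣? n) (upTo (suc n)) _ _ pt ⟩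
      sumMap (λ m → weight k n d m * 𝟙 (i ≡ᵇ exponent k n m) + - (weight k n d m * 𝟙 (i ≡ᵇ expRem k n m))) L
    ≡⟨ sumMap-+ _ _ L ⟩
      sumMap (λ m → weight k n d m * 𝟙 (i ≡ᵇ exponent k n m)) L + sumMap (λ m → - (weight k n d m * 𝟙 (i ≡ᵇ expRem k n m))) L
    ≡⟨ cong₂ _+_ (sym (coeff-S k n d i)) (sumMap-neg _ L) ⟩
      coeff (S k n d) i + - Rcoeff k n d i ∎
    where
    open ≡-Reasoning
    L : List ℕ
    L = between n d
    pt : ∀ m → (d ∣ m × m ∣ n) → weight k n d m * shift n (coeff (block k n m)) i + - (weight k n d m * coeff (block k n m) i) ≡ weight k n d m * 𝟙 (i ≡ᵇ exponent k n m) + - (weight k n d m * 𝟙 (i ≡ᵇ expRem k n m))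
    pt m (_ , m∣n) = trans (lem (weight k n d m) _ _) (trans (cong (weight k n d m *_) (geometric-telescopes (expRem k n m) n (expQuot k n m) i))
       (trans (cong (λ e → weight k n d m * (𝟙 (i ≡ᵇ e) + - 𝟙 (i ≡ᵇ expRem k n m))) (sym (exponent-divMod k n m n≥1 m∣n))) (sym (lem (weight k n d m) _ _))))
      where
      lem : ∀ c x y → c * x + - (c * y) ≡ c * (x + - y)
      lem = solve-∀

  weightʲ : ℕ → ℕ → ℕ → ℕ → ℤ
  weightʲ k n N j = μ j * neg1^ (k ℕ.* (n ∸ cofactor N j))

  expRemʲ : ℕ → ℕ → ℕ → ℕ → ℕ
  expRemʲ k n N j = if odd ((k ∸ 2) ℕ.* (cofactor N j ∸ 1)) then half n else 0

  exponentʲ : ℕ → ℕ → ℕ → ℕ → ℕ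
  exponentʲ k n N j = ((k ∸ 2) ℕ.* n ℕ.* (cofactor N j ∸ 1)) ÷ 2

  -- μ(j) (-1)^{k(n - N/j)} x^{r_j}, as a function of z = μ(j) and the parities of k, n and N/j.
  remainderTerm : ℕ → Bool → Bool → Bool → ℕ → ℤ → ℤ
  remainderTerm n ok on o i z = z * sgn (ok ∧ (on xor o)) * 𝟙 (i ≡ᵇ (if ok ∧ not o then half n else 0))

  remainderTerm-split : ∀ n ok on o i z → remainderTerm n ok on o i z ≡ when o z * (sgn (ok ∧ not on) * 𝟙 (i ≡ᵇ 0)) + when (not o) z * (sgn (ok ∧ on) * 𝟙 (i ≡ᵇ (if ok then half n else 0)))
  remainderTerm-split n ok on true i z = trans (cong (λ b → z * sgn (ok ∧ b) * 𝟙 (i ≡ᵇ (if ok ∧ false then half n else 0))) (xt on))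
    (trans (cong (λ b → z * sgn (ok ∧ not on) * 𝟙 (i ≡ᵇ (if b then half n else 0))) (BoolP.∧-zeroʳ ok))
    (trans (ℤP.*-assoc z _ _) (sym (trans (cong (λ v → z * (sgn (ok ∧ not on) * 𝟙 (i ≡ᵇ 0)) + v) (ℤP.*-zeroˡ (sgn (ok ∧ on) * 𝟙 (i ≡ᵇ (if ok then half n else 0))))) (ℤP.+-identityʳ _)))))
    where
    xt : ∀ b → b xor true ≡ not b
    xt true = refl
    xt false = refl
  remainderTerm-split n ok on false i z = trans (cong (λ b → z * sgn (ok ∧ b) * 𝟙 (i ≡ᵇ (if ok ∧ true then half n else 0))) (xf on))
    (trans (cong (λ b → z * sgn (ok ∧ on) * 𝟙 (i ≡ᵇ (if b then half n else 0))) (∧-true ok))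
    (trans (ℤP.*-assoc z _ _) (sym (trans (cong (λ v → v + z * (sgn (ok ∧ on) * 𝟙 (i ≡ᵇ (if ok then half n else 0)))) (ℤP.*-zeroˡ (sgn (ok ∧ not on) * 𝟙 (i ≡ᵇ 0)))) (ℤP.+-identityˡ _)))))
    where
    xf : ∀ b → b xor false ≡ b
    xf true = refl
    xf false = refl
    ∧-true : ∀ b → b ∧ true ≡ b
    ∧-true true = refl
    ∧-true false = refl

  divisorSum-remainderTerm : ∀ N n ok on i → 3 ≤ N → divisorSum N (λ j → remainderTerm n ok on (odd (cofactor N j)) i (μ j)) ≡ + 0
  divisorSum-remainderTerm N n ok on i N≥3 = begin
      divisorSum N (λ j → remainderTerm n ok on (odd (cofactor N j)) i (μ j))
    ≡⟨ divisorSum-cong N _ _ (λ j _ → remainderTerm-split n ok on (odd (cofactor N j)) i (μ j)) ⟩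
      divisorSum N (λ j → when (odd (cofactor N j)) (μ j) * X + when (not (odd (cofactor N j))) (μ j) * Y)
    ≡⟨ trans (divisorSum-+ N _ _) (cong₂ _+_ (divisorSum-* N _ X) (divisorSum-* N _ Y)) ⟩
      divisorSum N (λ j → when (odd (cofactor N j)) (μ j)) * X + divisorSum N (λ j → when (not (odd (cofactor N j))) (μ j)) * Y
    ≡⟨ cong₂ (λ a b → a * X + b * Y) Sodd (divisorSum-μ-evenCofactor N N≥3) ⟩
      + 0 * X + + 0 * Y
    ≡⟨ cong₂ _+_ (ℤP.*-zeroˡ X) (ℤP.*-zeroˡ Y) ⟩
      + 0 ∎
    where
    open ≡-Reasoning
    X Y : ℤ
    X = sgn (ok ∧ not on) * 𝟙 (i ≡ᵇ 0)
    Y = sgn (ok ∧ on) * 𝟙 (i ≡ᵇ (if ok then half n else 0))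
    N≥2 : 2 ≤ N
    N≥2 = ℕP.≤-trans (s≤s (s≤s z≤n)) N≥3
    tot : divisorSum N (λ j → when (odd (cofactor N j)) (μ j)) + divisorSum N (λ j → when (not (odd (cofactor N j))) (μ j)) ≡ + 0
    tot = trans (sym (divisorSum-+ N _ _)) (trans (divisorSum-cong N _ _ (λ j _ → when-sum (odd (cofactor N j)) (μ j))) (divisorSum-μ N N≥2))
    Sodd : divisorSum N (λ j → when (odd (cofactor N j)) (μ j)) ≡ + 0
    Sodd = trans (sym (ℤP.+-identityʳ _)) (trans (cong (λ z → divisorSum N (λ j → when (odd (cofactor N j)) (μ j)) + z) (sym (divisorSum-μ-evenCofactor N N≥3))) tot)

  RemainderIdentity : ℕ → ℕ → (ℕ → ℤ) → Set
  RemainderIdentity n d R = ∀ i → shift d R i + - R i ≡ R 0 * (𝟙 (i ≡ᵇ n) + - 𝟙 (i ≡ᵇ 0))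

  RemainderIdentity-0 : ∀ n d (R : ℕ → ℤ) → (∀ i → R i ≡ + 0) → RemainderIdentity n d R
  RemainderIdentity-0 n d R z i = trans (cong₂ (λ a b → a + - b) (trans (shift-cong d z i) (shift-zero d i)) (z i)) (sym (trans (cong (_* (𝟙 (i ≡ᵇ n) + - 𝟙 (i ≡ᵇ 0))) (z 0)) (ℤP.*-zeroˡ (𝟙 (i ≡ᵇ n) + - 𝟙 (i ≡ᵇ 0)))))

  RemainderIdentity-C : ∀ n d (R : ℕ → ℤ) → n ≡ d → (∀ i → R i ≡ R 0 * 𝟙 (i ≡ᵇ 0)) → RemainderIdentity n d R
  RemainderIdentity-C n d R n≡d R≡ i = begin
    shift d R i + - R i
      ≡⟨ cong₂ (λ x y → x + - y) (trans (shift-cong d R≡ i) (trans (shift-* d (R 0) _ i) (cong (R 0 *_) (shift-𝟙 d 0 i)))) (R≡ i) ⟩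
    R 0 * 𝟙 (i ≡ᵇ d ℕ.+ 0) + - (R 0 * 𝟙 (i ≡ᵇ 0))
      ≡⟨ cong (λ m → R 0 * 𝟙 (i ≡ᵇ m) + - (R 0 * 𝟙 (i ≡ᵇ 0))) (trans (ℕP.+-identityʳ d) (sym n≡d)) ⟩
    R 0 * 𝟙 (i ≡ᵇ n) + - (R 0 * 𝟙 (i ≡ᵇ 0))
      ≡⟨ lem (R 0) _ _ ⟩
    R 0 * (𝟙 (i ≡ᵇ n) + - 𝟙 (i ≡ᵇ 0)) ∎
    where
    open ≡-Reasoning
    lem : ∀ c x y → c * x + - (c * y) ≡ c * (x + - y)
    lem = solve-∀

  RemainderIdentity-X^+1 : ∀ n d (R : ℕ → ℤ) → n ≡ d ℕ.+ d → (∀ i → R i ≡ R 0 * (𝟙 (i ≡ᵇ d) + 𝟙 (i ≡ᵇ 0))) → RemainderIdentity n d R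
  RemainderIdentity-X^+1 n d R n≡d+d R≡ i = begin
    shift d R i + - R i
      ≡⟨ cong₂ (λ x y → x + - y) shifted (R≡ i) ⟩
    R 0 * (𝟙 (i ≡ᵇ d ℕ.+ d) + 𝟙 (i ≡ᵇ d ℕ.+ 0)) + - (R 0 * (𝟙 (i ≡ᵇ d) + 𝟙 (i ≡ᵇ 0)))
      ≡⟨ cong₂ (λ m m′ → R 0 * (𝟙 (i ≡ᵇ m) + 𝟙 (i ≡ᵇ m′)) + - (R 0 * (𝟙 (i ≡ᵇ d) + 𝟙 (i ≡ᵇ 0)))) (sym n≡d+d) (ℕP.+-identityʳ d) ⟩
    R 0 * (𝟙 (i ≡ᵇ n) + 𝟙 (i ≡ᵇ d)) + - (R 0 * (𝟙 (i ≡ᵇ d) + 𝟙 (i ≡ᵇ 0)))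
      ≡⟨ lem (R 0) (𝟙 (i ≡ᵇ n)) (𝟙 (i ≡ᵇ d)) (𝟙 (i ≡ᵇ 0)) ⟩
    R 0 * (𝟙 (i ≡ᵇ n) + - 𝟙 (i ≡ᵇ 0)) ∎
    where
    open ≡-Reasoning
    shifted : shift d R i ≡ R 0 * (𝟙 (i ≡ᵇ d ℕ.+ d) + 𝟙 (i ≡ᵇ d ℕ.+ 0))
    shifted = trans (shift-cong d R≡ i) (trans (shift-* d (R 0) _ i)
      (cong (R 0 *_) (trans (shift-+ d (λ j → 𝟙 (j ≡ᵇ d)) (λ j → 𝟙 (j ≡ᵇ 0)) i) (cong₂ _+_ (shift-𝟙 d d i) (shift-𝟙 d 0 i)))))
    lem : ∀ c x y z → c * (x + y) + - (c * (y + z)) ≡ c * (x + - z)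
    lem = solve-∀

  -- With n = N d and 2E = (k - 2) n (N - 1), both sides are polynomials in d, k - 2 and N - 1.
  degree-formula : ∀ d D E n N k → D ℕ.+ n ≡ d ℕ.+ E → E ℕ.* 2 ≡ (k ∸ 2) ℕ.* n ℕ.* (N ∸ 1) → n ≡ N ℕ.* d → 2 ≤ k → 1 ≤ N →
    + (2 ℕ.* d ℕ.* D) ≡ ((+ n ℤ.* (+ k ℤ.- + 2)) ℤ.- + (2 ℕ.* d)) ℤ.* (+ n ℤ.- + d)
  degree-formula d D E n N (suc zero) _ _ _ (s≤s ()) _
  degree-formula d D E n (suc m) (suc (suc a)) h1 h2 h3 _ _ = begin
      + (2 ℕ.* d ℕ.* D)
    ≡⟨ trans (ℤP.pos-* (2 ℕ.* d) D) (cong (_* + D) (ℤP.pos-* 2 d)) ⟩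
      + 2 * + d * + D
    ≡⟨ cong (λ x → + 2 * + d * x) xD ⟩
      + 2 * + d * (+ d + + E + - nn)
    ≡⟨ l1 (+ d) (+ E) nn ⟩
      + 2 * + d * (+ d + - nn) + + d * (+ E * + 2)
    ≡⟨ cong (λ z → + 2 * + d * (+ d + - nn) + + d * z) e2 ⟩
      + 2 * + d * (+ d + - nn) + + d * (+ a * nn * + m)
    ≡⟨ cong (λ z → + 2 * + d * (+ d + - z) + + d * (+ a * z * + m)) nnE ⟩
      + 2 * + d * (+ d + - ((+ m + + 1) * + d)) + + d * (+ a * ((+ m + + 1) * + d) * + m)
    ≡⟨ l2 (+ d) (+ a) (+ m) ⟩
      (((+ m + + 1) * + d) * ((+ a + + 2) + - + 2) + - (+ 2 * + d)) * ((+ m + + 1) * + d + - + d)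
    ≡⟨ sym (cong₂ (λ z v → (z * (v + - + 2) + - (+ 2 * + d)) * (z + - + d)) nnE kE) ⟩
      (nn * (+ suc (suc a) + - + 2) + - (+ 2 * + d)) * (nn + - + d)
    ≡⟨ cong (λ z → (nn * (+ suc (suc a) + - + 2) + - z) * (nn + - + d)) (sym (ℤP.pos-* 2 d)) ⟩
      ((+ n ℤ.* (+ suc (suc a) ℤ.- + 2)) ℤ.- + (2 ℕ.* d)) ℤ.* (+ n ℤ.- + d) ∎
    where
    open ≡-Reasoning
    nn : ℤ
    nn = + n
    xD : + D ≡ + d + + E + - nn
    xD = trans (sym (l0 (+ D) nn)) (cong (_+ - nn) (trans (sym (ℤP.pos-+ D n)) (trans (cong +_ h1) (ℤP.pos-+ d E))))
      where
      l0 : ∀ x y → x + y + - y ≡ x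
      l0 = solve-∀
    e2 : + E * + 2 ≡ + a * nn * + m
    e2 = trans (sym (ℤP.pos-* E 2)) (trans (cong +_ h2) (trans (ℤP.pos-* (a ℕ.* n) m) (cong (_* + m) (ℤP.pos-* a n))))
    nnE : nn ≡ (+ m + + 1) * + d
    nnE = trans (cong +_ (trans h3 (cong (ℕ._* d) (ℕP.+-comm 1 m)))) (trans (ℤP.pos-* (m ℕ.+ 1) d) (cong (_* + d) (ℤP.pos-+ m 1)))
    kE : + suc (suc a) ≡ + a + + 2
    kE = trans (cong +_ (ℕP.+-comm 2 a)) (ℤP.pos-+ a 2)
    l1 : ∀ dd e nn → + 2 * dd * (dd + e + - nn) ≡ + 2 * dd * (dd + - nn) + dd * (e * + 2)
    l1 = solve-∀
    l2 : ∀ dd a m → + 2 * dd * (dd + - ((m + + 1) * dd)) + dd * (a * ((m + + 1) * dd) * m) ≡ (((m + + 1) * dd) * ((a + + 2) + - + 2) + - (+ 2 * dd)) * ((m + + 1) * dd + - dd)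
    l2 = solve-∀

  -- The polynomial a

  module Construction (k N d' : ℕ) (k≥2 : 2 ≤ k) (N≥1 : 1 ≤ N) where

    d : ℕ
    d = suc d'

    n : ℕ
    n = N ℕ.* d

    n≥1 : 1 ≤ n
    n≥1 = ℕP.*-mono-≤ N≥1 (s≤s z≤n)

    wʲ : ℕ → ℤ
    wʲ = weightʲ k n N

    eʲ : ℕ → ℕ
    eʲ = exponentʲ k n N

    cS cW R : ℕ → ℤ
    cS = coeff (S k n d)
    cW = coeff (W k n d)
    R = Rcoeff k n d

    a₀ : ℤ
    a₀ = R 0

    a : Poly
    a = aPoly k n d

    cofactor-at : ∀ j → j ∣ N → cofactor n (j ℕ.* d) ≡ cofactor N j
    cofactor-at j (divides t N≡tj) = begin
      cofactor (N ℕ.* d) (j ℕ.* d)          ≡⟨ cong (λ M → cofactor (M ℕ.* d) (j ℕ.* d)) N≡tj ⟩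
      cofactor (t ℕ.* j ℕ.* d) (j ℕ.* d)    ≡⟨ cong (λ M → cofactor M (j ℕ.* d)) (ℕP.*-assoc t j d) ⟩
      cofactor (t ℕ.* (j ℕ.* d)) (j ℕ.* d)  ≡⟨ cofactor-*ʳ t (j ℕ.* d) (ℕP.*-mono-≤ j≥1 (s≤s z≤n)) ⟩
      t                                     ≡⟨ sym (cofactor-*ʳ t j j≥1) ⟩
      cofactor (t ℕ.* j) j                  ≡⟨ cong (λ M → cofactor M j) (sym N≡tj) ⟩
      cofactor N j                          ∎
      where
      open ≡-Reasoning
      j≥1 : 1 ≤ j
      j≥1 = divisor≥1 N≥1 (divides t N≡tj)

    weight-at : ∀ j → j ∣ N → weight k n d (j ℕ.* d) ≡ wʲ j
    weight-at j j∣N = cong₂ (λ m t → μ m * neg1^ (k ℕ.* (n ∸ t))) (m*n/n≡m j d) (cofactor-at j j∣N)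

    expRem-at : ∀ j → j ∣ N → expRem k n (j ℕ.* d) ≡ expRemʲ k n N j
    expRem-at j j∣N = cong (λ t → if odd ((k ∸ 2) ℕ.* (t ∸ 1)) then half n else 0) (cofactor-at j j∣N)

    exponent-at : ∀ j → j ∣ N → exponent k n (j ℕ.* d) ≡ eʲ j
    exponent-at j j∣N = cong (λ t → ((k ∸ 2) ℕ.* n ℕ.* (t ∸ 1)) ÷ 2) (cofactor-at j j∣N)

    jd∣n : ∀ j → j ∣ N → j ℕ.* d ∣ n
    jd∣n j j∣N = *-monoˡ-∣ d j∣N

    cS≡divisorSum : ∀ i → cS i ≡ divisorSum N (λ j → wʲ j * 𝟙 (i ≡ᵇ eʲ j))
    cS≡divisorSum i = trans (coeff-S k n d i) (trans (sumMap-between n N d' _ refl)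
      (divisorSum-cong N _ _ (λ j j∣N → cong₂ (λ c e → c * 𝟙 (i ≡ᵇ e)) (weight-at j j∣N) (exponent-at j j∣N))))

    cW≡divisorSum : ∀ i → cW i ≡ divisorSum N (λ j → wʲ j * coeff (block k n (j ℕ.* d)) i)
    cW≡divisorSum i = trans (coeff-W k n d i) (trans (sumMap-between n N d' _ refl)
      (divisorSum-cong N _ _ (λ j j∣N → cong (_* coeff (block k n (j ℕ.* d)) i) (weight-at j j∣N))))

    R≡divisorSum : ∀ i → R i ≡ divisorSum N (λ j → wʲ j * 𝟙 (i ≡ᵇ expRemʲ k n N j))
    R≡divisorSum i = trans (sumMap-between n N d' _ refl)
      (divisorSum-cong N _ _ (λ j j∣N → cong₂ (λ c r → c * 𝟙 (i ≡ᵇ r)) (weight-at j j∣N) (expRem-at j j∣N)))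

    cofactor-bounds : ∀ j → j ∣ N → 1 ≤ cofactor N j × cofactor N j ≤ n
    cofactor-bounds j (divides t N≡tj) = subst (1 ≤_) (sym t≡) 1≤t , subst (_≤ n) (sym t≡) t≤n
      where
      j≥1 : 1 ≤ j
      j≥1 = divisor≥1 N≥1 (divides t N≡tj)
      t≡ : cofactor N j ≡ t
      t≡ = trans (cong (λ M → cofactor M j) N≡tj) (cofactor-*ʳ t j j≥1)
      1≤t : 1 ≤ t
      1≤t = ℕP.n≢0⇒n>0 (λ t≡0 → ℕP.<⇒≱ N≥1 (ℕP.≤-reflexive (trans N≡tj (cong (ℕ._* j) t≡0))))
      t≤n : t ≤ n
      t≤n = ℕP.≤-trans (ℕP.≤-trans (ℕP.m≤m*n t j {{ℕ.>-nonZero j≥1}}) (ℕP.≤-reflexive (sym N≡tj))) (ℕP.m≤m*n N d)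

    cofactor∣n : ∀ j → j ∣ N → cofactor N j ∣ n
    cofactor∣n j (divides t N≡tj) = subst (_∣ n) (sym t≡) (∣-trans (divides j (trans N≡tj (ℕP.*-comm t j))) (m∣m*n d))
      where
      t≡ : cofactor N j ≡ t
      t≡ = trans (cong (λ M → cofactor M j) N≡tj) (cofactor-*ʳ t j (divisor≥1 N≥1 (divides t N≡tj)))

    -- The exponent (k - 2) n (N/j - 1) is even: if n is odd then so is its divisor N/j.
    eʲ*2 : ∀ j → j ∣ N → eʲ j ℕ.* 2 ≡ (k ∸ 2) ℕ.* n ℕ.* (cofactor N j ∸ 1)
    eʲ*2 j j∣N = trans (cong (λ z → z / 2 ℕ.* 2) X≡) (trans (cong (ℕ._* 2) (m*n/n≡m (half X) 2)) (sym X≡))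
      where
      X : ℕ
      X = (k ∸ 2) ℕ.* n ℕ.* (cofactor N j ∸ 1)
      odd-n⇒even : odd n ≡ true → odd (cofactor N j ∸ 1) ≡ false
      odd-n⇒even odd-n with odd (cofactor N j) in odd-t
      ... | true = trans (odd-∸1 (cofactor N j) (proj₁ (cofactor-bounds j j∣N))) (cong not odd-t)
      ... | false = contradiction (trans (sym (even-∣ (cofactor N j) n odd-t (cofactor∣n j j∣N))) odd-n) λ ()
      even-X : odd X ≡ false
      even-X = trans (odd-* ((k ∸ 2) ℕ.* n) _) (trans (cong (_∧ odd (cofactor N j ∸ 1)) (odd-* (k ∸ 2) n)) (parity (odd (k ∸ 2)) (odd n) refl))
        where
        parity : ∀ b c → odd n ≡ c → (b ∧ c) ∧ odd (cofactor N j ∸ 1) ≡ false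
        parity b false _ = cong (_∧ odd (cofactor N j ∸ 1)) (BoolP.∧-zeroʳ b)
        parity false true _ = refl
        parity true true odd-n = odd-n⇒even odd-n
      X≡ : X ≡ half X ℕ.* 2
      X≡ = even⇒half*2 X even-X

    remainderTerm-at : ∀ j → j ∣ N → ∀ i → wʲ j * 𝟙 (i ≡ᵇ expRemʲ k n N j) ≡ remainderTerm n (odd k) (odd n) (odd (cofactor N j)) i (μ j)
    remainderTerm-at j j∣N i = trans (cong (λ s → μ j * s * 𝟙 (i ≡ᵇ expRemʲ k n N j)) (neg1^-sgn (k ℕ.* (n ∸ cofactor N j))))
      (cong₂ (λ b c → μ j * sgn b * 𝟙 (i ≡ᵇ (if c then half n else 0)))
        (trans (odd-* k (n ∸ cofactor N j)) (cong (odd k ∧_) (odd-∸ n (cofactor N j) (proj₂ (cofactor-bounds j j∣N)))))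
        (trans (odd-* (k ∸ 2) (cofactor N j ∸ 1)) (cong₂ _∧_ (odd-∸2 k k≥2) (odd-∸1 (cofactor N j) (proj₁ (cofactor-bounds j j∣N))))))

    R≡remainderTerms : ∀ i → R i ≡ divisorSum N (λ j → remainderTerm n (odd k) (odd n) (odd (cofactor N j)) i (μ j))
    R≡remainderTerms i = trans (R≡divisorSum i) (divisorSum-cong N _ _ (λ j j∣N → remainderTerm-at j j∣N i))

    n≡d+d : N ≡ 2 → n ≡ d ℕ.+ d
    n≡d+d refl = cong (d ℕ.+_) (ℕP.+-identityʳ d)

    n-even : N ≡ 2 → odd n ≡ false
    n-even N≡2 = trans (cong odd (n≡d+d N≡2)) (odd-double d)

    neg1^-k[n∸1] : neg1^ (k ℕ.* (n ∸ 1)) ≡ sgn (odd k ∧ not (odd n))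
    neg1^-k[n∸1] = trans (neg1^-sgn (k ℕ.* (n ∸ 1))) (cong sgn (trans (odd-* k (n ∸ 1)) (cong (odd k ∧_) (odd-∸1 n n≥1))))

    neg1^-k[n∸2] : N ≡ 2 → neg1^ (k ℕ.* (n ∸ 2)) ≡ + 1
    neg1^-k[n∸2] N≡2 = trans (neg1^-sgn (k ℕ.* (n ∸ 2))) (cong sgn (trans (odd-* k (n ∸ 2))
      (trans (cong (odd k ∧_) (trans (odd-∸ n 2 n≥2) (cong (_xor false) (n-even N≡2)))) (BoolP.∧-zeroʳ (odd k)))))
      where
      n≥2 : 2 ≤ n
      n≥2 = subst (2 ≤_) (sym (n≡d+d N≡2)) (ℕP.+-mono-≤ (s≤s z≤n) (s≤s z≤n))

    R-N≡1 : N ≡ 1 → ∀ i → R i ≡ neg1^ (k ℕ.* (n ∸ 1)) * 𝟙 (i ≡ᵇ 0)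
    R-N≡1 N≡1 i = begin
      R i                                                          ≡⟨ R≡remainderTerms i ⟩
      divisorSum N (λ j → remainderTerm n (odd k) (odd n) (odd (cofactor N j)) i (μ j))
                                                                   ≡⟨ divisorSum-N≡1 N N≡1 (λ M j → remainderTerm n (odd k) (odd n) (odd (cofactor M j)) i (μ j)) ⟩
      + 1 * sgn (odd k ∧ (odd n xor true)) * 𝟙 (i ≡ᵇ (if odd k ∧ false then half n else 0))
                                                                   ≡⟨ cong₂ (λ b c → + 1 * sgn (odd k ∧ b) * 𝟙 (i ≡ᵇ (if c then half n else 0))) (xor-true (odd n)) (BoolP.∧-zeroʳ (odd k)) ⟩
      + 1 * sgn (odd k ∧ not (odd n)) * 𝟙 (i ≡ᵇ 0)                 ≡⟨ cong (λ s → s * 𝟙 (i ≡ᵇ 0)) (trans (ℤP.*-identityˡ _) (sym neg1^-k[n∸1])) ⟩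
      neg1^ (k ℕ.* (n ∸ 1)) * 𝟙 (i ≡ᵇ 0)                           ∎
      where
      open ≡-Reasoning
      xor-true : ∀ b → b xor true ≡ not b
      xor-true b = trans (BoolP.xor-comm b true) (BoolP.true-xor b)

    R-N≡2 : N ≡ 2 → ∀ i → R i ≡ 𝟙 (odd k) * (𝟙 (i ≡ᵇ d) + 𝟙 (i ≡ᵇ 0))
    R-N≡2 N≡2 i = begin
      R i                                                          ≡⟨ R≡remainderTerms i ⟩
      divisorSum N (λ j → remainderTerm n (odd k) (odd n) (odd (cofactor N j)) i (μ j))
                                                                   ≡⟨ divisorSum-N≡2 N N≡2 (λ M j → remainderTerm n (odd k) (odd n) (odd (cofactor M j)) i (μ j)) ⟩
      remainderTerm n (odd k) (odd n) false i (+ 1) + remainderTerm n (odd k) (odd n) true i (- + 1)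
                                                                   ≡⟨ cong (λ b → remainderTerm n (odd k) b false i (+ 1) + remainderTerm n (odd k) b true i (- + 1)) (n-even N≡2) ⟩
      remainderTerm n (odd k) false false i (+ 1) + remainderTerm n (odd k) false true i (- + 1)
                                                                   ≡⟨ by-parity (odd k) ⟩
      𝟙 (odd k) * (𝟙 (i ≡ᵇ d) + 𝟙 (i ≡ᵇ 0))                        ∎
      where
      open ≡-Reasoning
      half-n≡d : half n ≡ d
      half-n≡d = trans (cong half (n≡d+d N≡2)) (half-double d)
      by-parity : ∀ b → remainderTerm n b false false i (+ 1) + remainderTerm n b false true i (- + 1) ≡ 𝟙 b * (𝟙 (i ≡ᵇ d) + 𝟙 (i ≡ᵇ 0))
      by-parity true = trans (cong (λ h → + 1 * + 1 * 𝟙 (i ≡ᵇ h) + - + 1 * - + 1 * 𝟙 (i ≡ᵇ 0)) half-n≡d) (lem (𝟙 (i ≡ᵇ d)) (𝟙 (i ≡ᵇ 0)))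
        where
        lem : ∀ x y → + 1 * + 1 * x + - + 1 * - + 1 * y ≡ + 1 * (x + y)
        lem = solve-∀
      by-parity false = lem (𝟙 (i ≡ᵇ 0)) (𝟙 (i ≡ᵇ d))
        where
        lem : ∀ x y → + 1 * + 1 * x + - + 1 * + 1 * x ≡ + 0 * (y + x)
        lem = solve-∀

    R-N≥3 : 3 ≤ N → ∀ i → R i ≡ + 0
    R-N≥3 N≥3 i = trans (R≡remainderTerms i) (divisorSum-remainderTerm N n (odd k) (odd n) i N≥3)

    a₀-N≡2 : N ≡ 2 → a₀ ≡ 𝟙 (odd k)
    a₀-N≡2 N≡2 = trans (R-N≡2 N≡2 0) (ℤP.*-identityʳ (𝟙 (odd k)))

    remainderIdentity : RemainderIdentity n d R
    remainderIdentity with 1∨2∨≥3 N N≥1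
    ... | inj₁ N≡1 = RemainderIdentity-C n d R (trans (cong (ℕ._* d) N≡1) (ℕP.+-identityʳ d))
                       (λ i → trans (R-N≡1 N≡1 i) (cong (_* 𝟙 (i ≡ᵇ 0)) (sym (trans (R-N≡1 N≡1 0) (ℤP.*-identityʳ (neg1^ (k ℕ.* (n ∸ 1))))))))
    ... | inj₂ (inj₁ N≡2) = RemainderIdentity-X^+1 n d R (n≡d+d N≡2)
                              (λ i → trans (R-N≡2 N≡2 i) (cong (_* (𝟙 (i ≡ᵇ d) + 𝟙 (i ≡ᵇ 0))) (sym (a₀-N≡2 N≡2))))
    ... | inj₂ (inj₂ N≥3) = RemainderIdentity-0 n d R (R-N≥3 N≥3)

    coeff-a : ∀ i → coeff a i ≡ shift d cW i + - cW i + 𝟙 (i ≡ᵇ 0) * a₀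
    coeff-a i = trans (coeff-+ₚ (W k n d *ₚ (X^ d -ₚ C (+ 1))) (C a₀) i) (cong₂ _+_ (coeff-*ₚ-X^-1 (W k n d) d i) (coeff-C a₀ i))

    shiftⁿ-cW : ∀ i → shift n cW i ≡ cS i + - R i + cW i
    shiftⁿ-cW i = trans (sym (lem (shift n cW i) (cW i))) (cong (_+ cW i) (W-division k n d n≥1 i))
      where
      lem : ∀ x y → x + - y + y ≡ x
      lem = solve-∀

    shiftᵉ-coeff-a : ∀ e i → shift e (coeff a) i ≡ shift e (shift d cW) i + - shift e cW i + a₀ * 𝟙 (i ≡ᵇ e)
    shiftᵉ-coeff-a e i = begin
      shift e (coeff a) i
        ≡⟨ shift-cong e coeff-a i ⟩
      shift e (λ j → shift d cW j + - cW j + 𝟙 (j ≡ᵇ 0) * a₀) i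
        ≡⟨ shift-+ e _ (λ j → 𝟙 (j ≡ᵇ 0) * a₀) i ⟩
      shift e (λ j → shift d cW j + - cW j) i + shift e (λ j → 𝟙 (j ≡ᵇ 0) * a₀) i
        ≡⟨ cong₂ _+_ (trans (shift-+ e (shift d cW) (λ j → - cW j) i) (cong (λ z → shift e (shift d cW) i + z) (shift-neg e cW i))) shifted-constant ⟩
      shift e (shift d cW) i + - shift e cW i + a₀ * 𝟙 (i ≡ᵇ e) ∎
      where
      open ≡-Reasoning
      shifted-constant : shift e (λ j → 𝟙 (j ≡ᵇ 0) * a₀) i ≡ a₀ * 𝟙 (i ≡ᵇ e)
      shifted-constant = trans (shift-cong e (λ j → ℤP.*-comm (𝟙 (j ≡ᵇ 0)) a₀) i)
        (trans (shift-* e a₀ _ i) (cong (a₀ *_) (trans (shift-𝟙 e 0 i) (cong (λ m → 𝟙 (i ≡ᵇ m)) (ℕP.+-identityʳ e)))))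

    -- a (xⁿ - 1) = (xᵈ - 1)(xⁿ - 1) W + a₀ (xⁿ - 1) = (xᵈ - 1)(S - R) + (xᵈ - 1) R.
    isA : IsA k n d a
    isA i = begin
      coeff (a *ₚ (X^ n -ₚ C (+ 1))) i
        ≡⟨ coeff-*ₚ-X^-1 a n i ⟩
      shift n (coeff a) i + - coeff a i
        ≡⟨ cong₂ (λ x y → x + - y) (shiftᵉ-coeff-a n i) (coeff-a i) ⟩
      shift n (shift d cW) i + - shift n cW i + a₀ * 𝟙 (i ≡ᵇ n) + - (shift d cW i + - cW i + 𝟙 (i ≡ᵇ 0) * a₀)
        ≡⟨ cong (λ x → x + - shift n cW i + a₀ * 𝟙 (i ≡ᵇ n) + - (shift d cW i + - cW i + 𝟙 (i ≡ᵇ 0) * a₀)) shiftᵈ-shiftⁿ-cW ⟩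
      (shift d cS i + - shift d R i + shift d cW i) + - shift n cW i + a₀ * 𝟙 (i ≡ᵇ n) + - (shift d cW i + - cW i + 𝟙 (i ≡ᵇ 0) * a₀)
        ≡⟨ cong₂ (λ x y → (shift d cS i + - x + shift d cW i) + - y + a₀ * 𝟙 (i ≡ᵇ n) + - (shift d cW i + - cW i + 𝟙 (i ≡ᵇ 0) * a₀)) shiftᵈ-R (shiftⁿ-cW i) ⟩
      (shift d cS i + - (R i + a₀ * (𝟙 (i ≡ᵇ n) + - 𝟙 (i ≡ᵇ 0))) + shift d cW i) + - (cS i + - R i + cW i) + a₀ * 𝟙 (i ≡ᵇ n) + - (shift d cW i + - cW i + 𝟙 (i ≡ᵇ 0) * a₀)
        ≡⟨ lem (shift d cS i) (shift d cW i) (cS i) (R i) (cW i) a₀ (𝟙 (i ≡ᵇ n)) (𝟙 (i ≡ᵇ 0)) ⟩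
      shift d cS i + - cS i
        ≡⟨ sym (coeff-X^-1-*ₚ d (S k n d) i) ⟩
      coeff ((X^ d -ₚ C (+ 1)) *ₚ S k n d) i ∎
      where
      open ≡-Reasoning
      shiftᵈ-shiftⁿ-cW : shift n (shift d cW) i ≡ shift d cS i + - shift d R i + shift d cW i
      shiftᵈ-shiftⁿ-cW = trans (shift-comm n d cW i) (trans (shift-cong d shiftⁿ-cW i)
        (trans (shift-+ d _ cW i) (cong (_+ shift d cW i) (trans (shift-+ d cS _ i) (cong (λ z → shift d cS i + z) (shift-neg d R i))))))
      shiftᵈ-R : shift d R i ≡ R i + a₀ * (𝟙 (i ≡ᵇ n) + - 𝟙 (i ≡ᵇ 0))
      shiftᵈ-R = trans (sym (lem′ (shift d R i) (R i))) (cong (λ z → R i + z) (remainderIdentity i))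
        where
        lem′ : ∀ x y → y + (x + - y) ≡ x
        lem′ = solve-∀
      lem : ∀ A C D E F c X Y → (A + - (E + c * (X + - Y)) + C) + - (D + - E + F) + c * X + - (C + - F + Y * c) ≡ A + - D
      lem = solve-∀

    cW-vanishes : ∀ i → (∀ j → j ∣ N → eʲ j < i ℕ.+ n) → cW i ≡ + 0
    cW-vanishes i below = trans (cW≡divisorSum i) (divisorSum-zero N _ term≡0)
      where
      term≡0 : ∀ j → j ∣ N → wʲ j * coeff (block k n (j ℕ.* d)) i ≡ + 0
      term≡0 j j∣N = trans (cong (wʲ j *_) (coeff-geometric-above (expRem k n (j ℕ.* d)) n (expQuot k n (j ℕ.* d)) i
          (subst (_< i ℕ.+ n) (trans (sym (exponent-at j j∣N)) (exponent-divMod k n (j ℕ.* d) n≥1 (jd∣n j j∣N))) (below j j∣N))))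
        (ℤP.*-zeroʳ (wʲ j))

    W≈0 : (∀ j → j ∣ N → eʲ j < n) → ∀ i → cW i ≡ + 0
    W≈0 small i = cW-vanishes i (λ j j∣N → ℕP.<-≤-trans (small j j∣N) (ℕP.m≤n+m n i))

    a≈C : (∀ j → j ∣ N → eʲ j < n) → a ≈ₚ C a₀
    a≈C small i = begin
      coeff a i                                  ≡⟨ coeff-a i ⟩
      shift d cW i + - cW i + 𝟙 (i ≡ᵇ 0) * a₀    ≡⟨ cong₂ (λ x y → x + - y + 𝟙 (i ≡ᵇ 0) * a₀) (trans (shift-cong d (W≈0 small) i) (shift-zero d i)) (W≈0 small i) ⟩
      + 0 + - + 0 + 𝟙 (i ≡ᵇ 0) * a₀              ≡⟨ ℤP.+-identityˡ _ ⟩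
      𝟙 (i ≡ᵇ 0) * a₀                            ≡⟨ sym (coeff-C a₀ i) ⟩
      coeff (C a₀) i                             ∎
      where open ≡-Reasoning

    eʲ≡0 : ∀ j → j ∣ N → (k ∸ 2) ℕ.* (cofactor N j ∸ 1) ≡ 0 → eʲ j ≡ 0
    eʲ≡0 j j∣N zero-factor = ℕP.*-cancelʳ-≡ (eʲ j) 0 2 (trans (eʲ*2 j j∣N) (trans (ℕP.*-assoc (k ∸ 2) n _)
      (trans (cong ((k ∸ 2) ℕ.*_) (ℕP.*-comm n _)) (trans (sym (ℕP.*-assoc (k ∸ 2) _ n)) (cong (ℕ._* n) zero-factor)))))

    N≡1⇒small : N ≡ 1 → ∀ j → j ∣ N → eʲ j < n
    N≡1⇒small N≡1 j j∣N = subst (_< n) (sym (eʲ≡0 j j∣N (trans (cong (λ t → (k ∸ 2) ℕ.* (t ∸ 1)) cofactor≡1) (ℕP.*-zeroʳ (k ∸ 2))))) n≥1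
      where
      cofactor≡1 : cofactor N j ≡ 1
      cofactor≡1 with ∣1⇒≡1 (subst (j ∣_) N≡1 j∣N)
      ... | refl = cong (λ M → cofactor M 1) N≡1

    d≡n⇒N≡1 : d ≡ n → N ≡ 1
    d≡n⇒N≡1 d≡n = ℕP.*-cancelʳ-≡ N 1 d (trans (sym d≡n) (sym (ℕP.+-identityʳ d)))

    2d≡n⇒N≡2 : 2 ℕ.* d ≡ n → N ≡ 2
    2d≡n⇒N≡2 2d≡n = ℕP.*-cancelʳ-≡ N 2 d (sym 2d≡n)

    Xᵈ-1-divides-a : d ≢ n → 2 ℕ.* d ≢ n → Σ Poly λ r → r *ₚ (X^ d -ₚ C (+ 1)) ≈ₚ a
    Xᵈ-1-divides-a d≢n 2d≢n = W k n d , λ i → sym (trans (coeff-+ₚ (W k n d *ₚ (X^ d -ₚ C (+ 1))) (C a₀) i)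
      (trans (cong (λ z → coeff (W k n d *ₚ (X^ d -ₚ C (+ 1))) i + z) (trans (coeff-C a₀ i) (trans (cong (𝟙 (i ≡ᵇ 0) *_) (R-N≥3 N≥3 0)) (ℤP.*-zeroʳ (𝟙 (i ≡ᵇ 0))))))
      (ℤP.+-identityʳ _)))
      where
      N≥3 : 3 ≤ N
      N≥3 with 1∨2∨≥3 N N≥1
      ... | inj₁ N≡1 = ⊥-elim (d≢n (sym (trans (cong (ℕ._* d) N≡1) (ℕP.+-identityʳ d))))
      ... | inj₂ (inj₁ N≡2) = ⊥-elim (2d≢n (sym (cong (ℕ._* d) N≡2)))
      ... | inj₂ (inj₂ N≥3) = N≥3

    a-when-d≡n : d ≡ n → a ≈ₚ C (neg1^ (k ℕ.* (n ∸ 1)))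
    a-when-d≡n d≡n i = trans (a≈C (N≡1⇒small N≡1) i) (cong (λ c → coeff (C c) i) (trans (R-N≡1 N≡1 0) (ℤP.*-identityʳ _)))
      where
      N≡1 : N ≡ 1
      N≡1 = d≡n⇒N≡1 d≡n

    S-N≡2 : N ≡ 2 → ∀ i → cS i ≡ 𝟙 (i ≡ᵇ (k ∸ 2) ℕ.* d) + 𝟙 (i ≡ᵇ 0) * neg1^ (k ℕ.+ 1)
    S-N≡2 N≡2 i = begin
      cS i
        ≡⟨ cS≡divisorSum i ⟩
      divisorSum N (λ j → wʲ j * 𝟙 (i ≡ᵇ eʲ j))
        ≡⟨ divisorSum-N≡2 N N≡2 (λ M j → weightʲ k n M j * 𝟙 (i ≡ᵇ exponentʲ k n M j)) ⟩
      + 1 * neg1^ (k ℕ.* (n ∸ 2)) * 𝟙 (i ≡ᵇ exponentʲ k n 2 1) + - + 1 * neg1^ (k ℕ.* (n ∸ 1)) * 𝟙 (i ≡ᵇ exponentʲ k n 2 2)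
        ≡⟨ cong₂ (λ x y → + 1 * neg1^ (k ℕ.* (n ∸ 2)) * 𝟙 (i ≡ᵇ x) + - + 1 * neg1^ (k ℕ.* (n ∸ 1)) * 𝟙 (i ≡ᵇ y)) e₁ e₂ ⟩
      + 1 * neg1^ (k ℕ.* (n ∸ 2)) * 𝟙 (i ≡ᵇ (k ∸ 2) ℕ.* d) + - + 1 * neg1^ (k ℕ.* (n ∸ 1)) * 𝟙 (i ≡ᵇ 0)
        ≡⟨ cong₂ (λ x y → + 1 * x * 𝟙 (i ≡ᵇ (k ∸ 2) ℕ.* d) + - + 1 * y * 𝟙 (i ≡ᵇ 0)) (neg1^-k[n∸2] N≡2) sign₂ ⟩
      + 1 * + 1 * 𝟙 (i ≡ᵇ (k ∸ 2) ℕ.* d) + - + 1 * sgn (odd k) * 𝟙 (i ≡ᵇ 0)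
        ≡⟨ by-parity (odd k) (𝟙 (i ≡ᵇ (k ∸ 2) ℕ.* d)) (𝟙 (i ≡ᵇ 0)) ⟩
      𝟙 (i ≡ᵇ (k ∸ 2) ℕ.* d) + 𝟙 (i ≡ᵇ 0) * sgn (odd k xor true)
        ≡⟨ cong (λ s → 𝟙 (i ≡ᵇ (k ∸ 2) ℕ.* d) + 𝟙 (i ≡ᵇ 0) * s) (sym (trans (neg1^-sgn (k ℕ.+ 1)) (cong sgn (odd-+ k 1)))) ⟩
      𝟙 (i ≡ᵇ (k ∸ 2) ℕ.* d) + 𝟙 (i ≡ᵇ 0) * neg1^ (k ℕ.+ 1) ∎
      where
      open ≡-Reasoning
      e₁ : exponentʲ k n 2 1 ≡ (k ∸ 2) ℕ.* d
      e₁ = trans (cong (_/ 2) (trans (cong (λ z → (k ∸ 2) ℕ.* z ℕ.* 1) (n≡d+d N≡2)) (lem (k ∸ 2) d))) (m*n/n≡m ((k ∸ 2) ℕ.* d) 2)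
        where
        lem : ∀ x y → x ℕ.* (y ℕ.+ y) ℕ.* 1 ≡ x ℕ.* y ℕ.* 2
        lem = NS.solve-∀
      e₂ : exponentʲ k n 2 2 ≡ 0
      e₂ = cong (_/ 2) (ℕP.*-zeroʳ ((k ∸ 2) ℕ.* n))
      sign₂ : neg1^ (k ℕ.* (n ∸ 1)) ≡ sgn (odd k)
      sign₂ = trans neg1^-k[n∸1] (cong sgn (trans (cong (λ b → odd k ∧ not b) (n-even N≡2)) (BoolP.∧-identityʳ (odd k))))
      by-parity : ∀ b x y → + 1 * + 1 * x + - + 1 * sgn b * y ≡ x + y * sgn (b xor true)
      by-parity true = lem
        where
        lem : ∀ x y → + 1 * + 1 * x + - + 1 * - + 1 * y ≡ x + y * + 1
        lem = solve-∀
      by-parity false = lem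
        where
        lem : ∀ x y → + 1 * + 1 * x + - + 1 * + 1 * y ≡ x + y * - + 1
        lem = solve-∀

    a*Xᵈ+1-when-2d≡n : 2 ℕ.* d ≡ n → a *ₚ (X^ d +ₚ C (+ 1)) ≈ₚ X^ ((k ∸ 2) ℕ.* d) +ₚ C (neg1^ (k ℕ.+ 1))
    a*Xᵈ+1-when-2d≡n 2d≡n i = begin
      coeff (a *ₚ (X^ d +ₚ C (+ 1))) i
        ≡⟨ coeff-*ₚ-X^+1 a d i ⟩
      shift d (coeff a) i + coeff a i
        ≡⟨ cong₂ _+_ (shiftᵉ-coeff-a d i) (coeff-a i) ⟩
      (shift d (shift d cW) i + - shift d cW i + a₀ * 𝟙 (i ≡ᵇ d)) + (shift d cW i + - cW i + 𝟙 (i ≡ᵇ 0) * a₀)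
        ≡⟨ cong (λ x → (x + - shift d cW i + a₀ * 𝟙 (i ≡ᵇ d)) + (shift d cW i + - cW i + 𝟙 (i ≡ᵇ 0) * a₀)) shiftᵈ-shiftᵈ-cW ⟩
      ((cS i + - R i + cW i) + - shift d cW i + a₀ * 𝟙 (i ≡ᵇ d)) + (shift d cW i + - cW i + 𝟙 (i ≡ᵇ 0) * a₀)
        ≡⟨ cong (λ x → ((cS i + - x + cW i) + - shift d cW i + a₀ * 𝟙 (i ≡ᵇ d)) + (shift d cW i + - cW i + 𝟙 (i ≡ᵇ 0) * a₀)) R≡ ⟩
      ((cS i + - (a₀ * (𝟙 (i ≡ᵇ d) + 𝟙 (i ≡ᵇ 0))) + cW i) + - shift d cW i + a₀ * 𝟙 (i ≡ᵇ d)) + (shift d cW i + - cW i + 𝟙 (i ≡ᵇ 0) * a₀)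
        ≡⟨ lem (cS i) a₀ (𝟙 (i ≡ᵇ d)) (𝟙 (i ≡ᵇ 0)) (cW i) (shift d cW i) ⟩
      cS i
        ≡⟨ S-N≡2 N≡2 i ⟩
      𝟙 (i ≡ᵇ (k ∸ 2) ℕ.* d) + 𝟙 (i ≡ᵇ 0) * neg1^ (k ℕ.+ 1)
        ≡⟨ sym (trans (coeff-+ₚ (X^ ((k ∸ 2) ℕ.* d)) (C (neg1^ (k ℕ.+ 1))) i) (cong₂ _+_ (coeff-X^ _ i) (coeff-C _ i))) ⟩
      coeff (X^ ((k ∸ 2) ℕ.* d) +ₚ C (neg1^ (k ℕ.+ 1))) i ∎
      where
      open ≡-Reasoning
      N≡2 : N ≡ 2
      N≡2 = 2d≡n⇒N≡2 2d≡n
      shiftᵈ-shiftᵈ-cW : shift d (shift d cW) i ≡ cS i + - R i + cW i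
      shiftᵈ-shiftᵈ-cW = trans (shift-shift d d cW i) (trans (cong (λ m → shift m cW i) (sym (n≡d+d N≡2))) (shiftⁿ-cW i))
      R≡ : R i ≡ a₀ * (𝟙 (i ≡ᵇ d) + 𝟙 (i ≡ᵇ 0))
      R≡ = trans (R-N≡2 N≡2 i) (cong (_* (𝟙 (i ≡ᵇ d) + 𝟙 (i ≡ᵇ 0))) (sym (a₀-N≡2 N≡2)))
      lem : ∀ S c X Y W V → ((S + - (c * (X + Y)) + W) + - V + c * X) + (V + - W + Y * c) ≡ S
      lem = solve-∀

    a-when-k≡2 : k ≡ 2 → a ≈ₚ C (δ (n ℕ.≟ d))
    a-when-k≡2 k≡2 i = trans (a≈C small i) (cong (λ c → coeff (C c) i) a₀≡δ)
      where
      small : ∀ j → j ∣ N → eʲ j < n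
      small j j∣N = subst (_< n) (sym (eʲ≡0 j j∣N (cong (λ k′ → (k′ ∸ 2) ℕ.* (cofactor N j ∸ 1)) k≡2))) n≥1
      a₀≡δ : a₀ ≡ δ (n ℕ.≟ d)
      a₀≡δ with 1∨2∨≥3 N N≥1 | n ℕ.≟ d
      ... | inj₁ N≡1 | yes _ = trans (trans (R-N≡1 N≡1 0) (ℤP.*-identityʳ _)) (trans neg1^-k[n∸1] (cong (λ k′ → sgn (odd k′ ∧ not (odd n))) k≡2))
      ... | inj₁ N≡1 | no n≢d = ⊥-elim (n≢d (trans (cong (ℕ._* d) N≡1) (ℕP.+-identityʳ d)))
      ... | inj₂ (inj₁ N≡2) | yes n≡d = contradiction (trans (sym (d≡n⇒N≡1 (sym n≡d))) N≡2) λ ()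
      ... | inj₂ (inj₁ N≡2) | no _ = trans (a₀-N≡2 N≡2) (cong (λ k′ → 𝟙 (odd k′)) k≡2)
      ... | inj₂ (inj₂ N≥3) | yes n≡d = contradiction (subst (3 ≤_) (d≡n⇒N≡1 (sym n≡d)) N≥3) λ { (s≤s ()) }
      ... | inj₂ (inj₂ N≥3) | no _ = R-N≥3 N≥3 0

    module LeadingTerm (k≥3 : 3 ≤ k) where

      E : ℕ
      E = eʲ 1

      ε : ℤ
      ε = neg1^ (k ℕ.* (n ∸ (n ÷ d)))

      n÷d≡N : n ÷ d ≡ N
      n÷d≡N = m*n/n≡m N d

      cofactor-1 : cofactor N 1 ≡ N
      cofactor-1 = n/1≡n N

      wʲ-1 : wʲ 1 ≡ ε
      wʲ-1 = trans (ℤP.*-identityˡ _) (cong (λ t → neg1^ (k ℕ.* (n ∸ t))) (trans cofactor-1 (sym n÷d≡N)))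

      [k∸2]n≥1 : 1 ≤ (k ∸ 2) ℕ.* n
      [k∸2]n≥1 = ℕP.*-mono-≤ (ℕP.∸-monoˡ-≤ 2 k≥3) n≥1

      E*2 : E ℕ.* 2 ≡ (k ∸ 2) ℕ.* n ℕ.* (N ∸ 1)
      E*2 = trans (eʲ*2 1 (1∣ N)) (cong (λ t → (k ∸ 2) ℕ.* n ℕ.* (t ∸ 1)) cofactor-1)

      cofactor*j : ∀ j → j ∣ N → cofactor N j ℕ.* j ≡ N
      cofactor*j j (divides t N≡tj) = trans (cong (ℕ._* j) (trans (cong (λ M → cofactor M j) N≡tj) (cofactor-*ʳ t j (divisor≥1 N≥1 (divides t N≡tj))))) (sym N≡tj)

      cofactor-anti : ∀ j j′ → j ∣ N → j′ ∣ N → j < j′ → cofactor N j′ < cofactor N j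
      cofactor-anti j j′ j∣N j′∣N j<j′ = ℕP.*-cancelʳ-< j′ (cofactor N j′) (cofactor N j) (begin-strict
        cofactor N j′ ℕ.* j′    ≡⟨ cofactor*j j′ j′∣N ⟩
        N                       ≡⟨ sym (cofactor*j j j∣N) ⟩
        cofactor N j ℕ.* j      <⟨ ℕP.*-monoʳ-< (cofactor N j) {{ℕ.>-nonZero (proj₁ (cofactor-bounds j j∣N))}} j<j′ ⟩
        cofactor N j ℕ.* j′     ∎)
        where open ℕP.≤-Reasoning

      eʲ-mono : ∀ j j′ → j ∣ N → j′ ∣ N → cofactor N j < cofactor N j′ → eʲ j < eʲ j′
      eʲ-mono j j′ j∣N j′∣N lt = ℕP.*-cancelʳ-< 2 (eʲ j) (eʲ j′) (subst₂ _<_ (sym (eʲ*2 j j∣N)) (sym (eʲ*2 j′ j′∣N))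
        (ℕP.*-monoʳ-< ((k ∸ 2) ℕ.* n) {{ℕ.>-nonZero [k∸2]n≥1}} (ℕP.∸-monoˡ-< lt (proj₁ (cofactor-bounds j j∣N)))))

      eʲ<E : ∀ j → j ∣ N → j ≢ 1 → eʲ j < E
      eʲ<E j j∣N j≢1 = eʲ-mono j 1 j∣N (1∣ N) (cofactor-anti 1 j (1∣ N) j∣N (≢1⇒>1 j (divisor≥1 N≥1 j∣N) j≢1))

      eʲ≤E : ∀ j → j ∣ N → eʲ j ≤ E
      eʲ≤E j j∣N with j ℕ.≟ 1
      ... | yes refl = ℕP.≤-refl
      ... | no j≢1 = ℕP.<⇒≤ (eʲ<E j j∣N j≢1)

      cW-above : ∀ i → E < i ℕ.+ n → cW i ≡ + 0
      cW-above i E<i+n = cW-vanishes i (λ j j∣N → ℕP.≤-<-trans (eʲ≤E j j∣N) E<i+n)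

      -- Only the block of j = 1 reaches the exponent E, with coefficient w₁ = ε.
      cW-top : n ≤ E → cW (E ∸ n) ≡ ε
      cW-top n≤E = trans (cW≡divisorSum (E ∸ n)) (trans (divisorSum-only1 N _ N≥1 lower) (trans (cong₂ _*_ wʲ-1 top) (ℤP.*-identityʳ ε)))
        where
        lower : ∀ j → j ∣ N → j ≢ 1 → wʲ j * coeff (block k n (j ℕ.* d)) (E ∸ n) ≡ + 0
        lower j j∣N j≢1 = trans (cong (wʲ j *_) (coeff-geometric-above (expRem k n (j ℕ.* d)) n (expQuot k n (j ℕ.* d)) (E ∸ n)
            (subst₂ _<_ (trans (sym (exponent-at j j∣N)) (exponent-divMod k n (j ℕ.* d) n≥1 (jd∣n j j∣N))) (sym (ℕP.m∸n+n≡m n≤E)) (eʲ<E j j∣N j≢1))))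
          (ℤP.*-zeroʳ (wʲ j))
        top : coeff (block k n (1 ℕ.* d)) (E ∸ n) ≡ + 1
        top = coeff-geometric-top′ (expRem k n (1 ℕ.* d)) n (expQuot k n (1 ℕ.* d)) E n≥1 (expRem<n k n (1 ℕ.* d) n≥1) n≤E
          (trans (sym (exponent-at 1 (1∣ N))) (exponent-divMod k n (1 ℕ.* d) n≥1 (jd∣n 1 (1∣ N))))

      leading-n≤E : n ≤ E → HasDegLead a (d ℕ.+ (E ∸ n)) ε
      leading-n≤E n≤E = top , neg1^≢0 (k ℕ.* (n ∸ (n ÷ d))) , above
        where
        E′ : ℕ
        E′ = E ∸ n
        E≡ : E ≡ E′ ℕ.+ n
        E≡ = sym (ℕP.m∸n+n≡m n≤E)
        top : coeff a (d ℕ.+ E′) ≡ ε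
        top = begin
          coeff a (d ℕ.+ E′)                                                      ≡⟨ coeff-a (d ℕ.+ E′) ⟩
          shift d cW (d ℕ.+ E′) + - cW (d ℕ.+ E′) + 𝟙 (d ℕ.+ E′ ≡ᵇ 0) * a₀        ≡⟨ cong₂ (λ x y → x + - y + + 0 * a₀) (trans (shift-at d cW E′) (cW-top n≤E)) (cW-above (d ℕ.+ E′) E<) ⟩
          ε + - + 0 + + 0 * a₀                                                    ≡⟨ lem ε a₀ ⟩
          ε                                                                       ∎
          where
          open ≡-Reasoning
          lem : ∀ x y → x + - + 0 + + 0 * y ≡ x
          lem = solve-∀
          E< : E < d ℕ.+ E′ ℕ.+ n
          E< = subst (_< d ℕ.+ E′ ℕ.+ n) (sym E≡) (subst (E′ ℕ.+ n <_) (sym (ℕP.+-assoc d E′ n)) (ℕP.m<n+m (E′ ℕ.+ n) {d} (s≤s z≤n)))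
        above : ∀ i → d ℕ.+ E′ < i → coeff a i ≡ + 0
        above i D<i = begin
          coeff a i                                  ≡⟨ coeff-a i ⟩
          shift d cW i + - cW i + 𝟙 (i ≡ᵇ 0) * a₀    ≡⟨ cong₂ (λ x y → x + - y + 𝟙 (i ≡ᵇ 0) * a₀) shifted unshifted ⟩
          + 0 + - + 0 + 𝟙 (i ≡ᵇ 0) * a₀              ≡⟨ cong (λ z → + 0 + - + 0 + z) (𝟙-suc i a₀ (ℕP.≤-trans (s≤s z≤n) D<i)) ⟩
          + 0                                        ∎
          where
          open ≡-Reasoning
          d≤i : d ≤ i
          d≤i = ℕP.≤-trans (ℕP.m≤m+n d E′) (ℕP.<⇒≤ D<i)
          i≡ : i ≡ d ℕ.+ (i ∸ d)
          i≡ = sym (ℕP.m+[n∸m]≡n d≤i)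
          E′< : E′ < i ∸ d
          E′< = ℕP.+-cancelˡ-< d E′ (i ∸ d) (subst (d ℕ.+ E′ <_) i≡ D<i)
          shifted : shift d cW i ≡ + 0
          shifted = trans (cong (shift d cW) i≡) (trans (shift-at d cW (i ∸ d)) (cW-above (i ∸ d) (subst (_< (i ∸ d) ℕ.+ n) (sym E≡) (ℕP.+-monoˡ-< n E′<))))
          unshifted : cW i ≡ + 0
          unshifted = cW-above i (subst (_< i ℕ.+ n) (sym E≡) (ℕP.+-monoˡ-< n (ℕP.<-≤-trans E′< (ℕP.m∸n≤m i d))))

      E<n-cases : E < n → (N ≡ 1 × E ≡ 0) ⊎ (N ≡ 2 × k ≡ 3 × E ≡ d)
      E<n-cases E<n with 1∨2∨≥3 N N≥1
      ... | inj₁ N≡1 = inj₁ (N≡1 , ℕP.*-cancelʳ-≡ E 0 2 (trans E*2 (trans (cong (λ t → (k ∸ 2) ℕ.* n ℕ.* (t ∸ 1)) N≡1) (ℕP.*-zeroʳ ((k ∸ 2) ℕ.* n)))))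
      ... | inj₂ (inj₂ N≥3) = contradiction (subst (n ℕ.* 2 ≤_) (sym E*2) big) (ℕP.<⇒≱ (ℕP.*-monoˡ-< 2 E<n))
        where
        big : n ℕ.* 2 ≤ (k ∸ 2) ℕ.* n ℕ.* (N ∸ 1)
        big = ℕP.*-mono-≤ (subst (_≤ (k ∸ 2) ℕ.* n) (ℕP.*-identityˡ n) (ℕP.*-monoˡ-≤ n (ℕP.∸-monoˡ-≤ 2 k≥3))) (ℕP.∸-monoˡ-≤ 1 N≥3)
      ... | inj₂ (inj₁ N≡2) = inj₂ (N≡2 , k≡3∧E≡d k k≥3 refl)
        where
        E*2≡ : E ℕ.* 2 ≡ (k ∸ 2) ℕ.* n
        E*2≡ = trans E*2 (trans (cong (λ t → (k ∸ 2) ℕ.* n ℕ.* (t ∸ 1)) N≡2) (ℕP.*-identityʳ _))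
        k≡3∧E≡d : ∀ k′ → 3 ≤ k′ → k′ ≡ k → k ≡ 3 × E ≡ d
        k≡3∧E≡d 0 () _
        k≡3∧E≡d 1 (s≤s ()) _
        k≡3∧E≡d 2 (s≤s (s≤s ())) _
        k≡3∧E≡d 3 _ refl = refl , ℕP.*-cancelʳ-≡ E d 2 (trans E*2≡ (trans (ℕP.+-identityʳ n) (trans (n≡d+d N≡2) (lem d))))
          where
          lem : ∀ x → x ℕ.+ x ≡ x ℕ.* 2
          lem = NS.solve-∀
        k≡3∧E≡d (suc (suc (suc (suc k′′)))) _ refl = contradiction (subst (n ℕ.* 2 ≤_) (sym E*2≡)
          (subst (_≤ (2 ℕ.+ k′′) ℕ.* n) (ℕP.*-comm 2 n) (ℕP.*-monoˡ-≤ n (ℕP.m≤m+n 2 k′′)))) (ℕP.<⇒≱ (ℕP.*-monoˡ-< 2 E<n))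

      leading-E<n : E < n → HasDegLead a 0 ε × d ℕ.+ E ≡ n
      leading-E<n E<n = (trans (a≈C small 0) a₀≡ε , neg1^≢0 (k ℕ.* (n ∸ (n ÷ d))) , λ { zero () ; (suc i) _ → a≈C small (suc i) }) , d+E≡n
        where
        small : ∀ j → j ∣ N → eʲ j < n
        small j j∣N = ℕP.≤-<-trans (eʲ≤E j j∣N) E<n
        d+E≡n : d ℕ.+ E ≡ n
        d+E≡n with E<n-cases E<n
        ... | inj₁ (N≡1 , E≡0) = trans (cong (d ℕ.+_) E≡0) (trans (ℕP.+-identityʳ d) (sym (trans (cong (ℕ._* d) N≡1) (ℕP.+-identityʳ d))))
        ... | inj₂ (N≡2 , _ , E≡d) = trans (cong (d ℕ.+_) E≡d) (sym (n≡d+d N≡2))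
        a₀≡ε : a₀ ≡ ε
        a₀≡ε with E<n-cases E<n
        ... | inj₁ (N≡1 , _) = trans (R-N≡1 N≡1 0) (trans (ℤP.*-identityʳ _) (cong (λ t → neg1^ (k ℕ.* (n ∸ t))) (sym (trans n÷d≡N N≡1))))
        ... | inj₂ (N≡2 , k≡3 , _) = trans (a₀-N≡2 N≡2) (trans (cong (λ k′ → 𝟙 (odd k′)) k≡3)
              (sym (trans (cong (λ t → neg1^ (k ℕ.* (n ∸ t))) (trans n÷d≡N N≡2)) (neg1^-k[n∸2] N≡2))))

      degree-and-lead-of-a : Σ ℕ λ D → HasDegLead a D ε × (+ (2 ℕ.* d ℕ.* D) ≡ ((+ n ℤ.* (+ k ℤ.- + 2)) ℤ.- + (2 ℕ.* d)) ℤ.* (+ n ℤ.- + d))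
      degree-and-lead-of-a with n ℕP.≤? E
      ... | yes n≤E = d ℕ.+ (E ∸ n) , leading-n≤E n≤E , degree-formula d _ E n N k D+n≡d+E E*2 refl k≥2 N≥1
        where
        D+n≡d+E : d ℕ.+ (E ∸ n) ℕ.+ n ≡ d ℕ.+ E
        D+n≡d+E = trans (ℕP.+-assoc d (E ∸ n) n) (cong (d ℕ.+_) (ℕP.m∸n+n≡m n≤E))
      ... | no n≰E = 0 , proj₁ (leading-E<n E<n) , degree-formula d 0 E n N k (sym (proj₂ (leading-E<n E<n))) E*2 refl k≥2 N≥1
        where
        E<n : E < n
        E<n = ℕP.≰⇒> n≰E

      eval-S : ∀ x → eval (S k n d) x ≡ divisorSum N (λ j → wʲ j * x ℤ.^ eʲ j)
      eval-S x = trans (eval-sumₚ (term k n d) (between n d) x)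
        (trans (sumMap-cong _ _ (between n d) (λ m → trans (eval-·ₚ (weight k n d m) (X^ (exponent k n m)) x) (cong (weight k n d m *_) (eval-X^ (exponent k n m) x))))
        (trans (sumMap-between n N d' _ refl) (divisorSum-cong N _ _ (λ j j∣N → cong₂ (λ c e → c * x ℤ.^ e) (weight-at j j∣N) (exponent-at j j∣N)))))

      -- The term ε w₁ q^E = q^E dominates: the other exponents are distinct and smaller, and |wⱼ| ≤ 1.
      ε*S>0 : ∀ q → 2 ≤ q → + 0 ℤ.< ε * eval (S k n d) (+ q)
      ε*S>0 q q≥2 = begin-strict
        + 0                 ≡⟨ sym (ℤP.+-inverseʳ xᴱ) ⟩
        xᴱ + - xᴱ           <⟨ ℤP.+-monoʳ-< xᴱ (ℤP.neg-mono-< V<xᴱ) ⟩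
        xᴱ + - V            ≤⟨ ℤP.+-monoʳ-≤ xᴱ -V≤ε*rest ⟩
        xᴱ + ε * rest       ≡⟨ sym ε*S≡ ⟩
        ε * eval (S k n d) x ∎
        where
        open ℤP.≤-Reasoning
        x : ℤ
        x = + q
        xᴱ : ℤ
        xᴱ = x ℤ.^ E
        f : ℕ → ℤ
        f j = wʲ j * x ℤ.^ eʲ j
        P : ℕ → Bool
        P i = does (suc (suc i) ∣? N)
        g : ℕ → ℕ
        g i = eʲ (suc (suc i))
        rest V : ℤ
        rest = sumTo (N ∸ 1) (λ i → when (P i) (f (suc (suc i))))
        V = sumTo (N ∸ 1) (λ i → when (P i) (x ℤ.^ g i))
        ε*S≡ : ε * eval (S k n d) x ≡ xᴱ + ε * rest
        ε*S≡ = trans (cong (ε *_) (trans (eval-S x) (divisorSum-split1 N f N≥1)))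
          (trans (ℤP.*-distribˡ-+ ε (f 1) rest) (cong (_+ ε * rest) (trans (cong (λ c → ε * (c * xᴱ)) wʲ-1)
          (trans (sym (ℤP.*-assoc ε ε xᴱ)) (trans (cong (_* xᴱ) (ε*ε)) (ℤP.*-identityˡ xᴱ))))))
          where
          ε*ε : ε * ε ≡ + 1
          ε*ε = trans (cong₂ _*_ (neg1^-sgn (k ℕ.* (n ∸ (n ÷ d)))) (neg1^-sgn (k ℕ.* (n ∸ (n ÷ d))))) (sgn-sq (odd (k ℕ.* (n ∸ (n ÷ d)))))
        V<xᴱ : V ℤ.< xᴱ
        V<xᴱ = subst₂ ℤ._<_ (sym V≡) (sym (pow-pos q E)) (ℤ.+<+ (sum-of-distinct-powers< q q≥2 (N ∸ 1) P g E below decreasing))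
          where
          V≡ : V ≡ + sumToℕ (N ∸ 1) (λ i → if P i then q ℕ.^ g i else 0)
          V≡ = trans (sumTo-cong (N ∸ 1) (λ i _ → trans (cong (when (P i)) (pow-pos q (g i))) (when-pos (P i) _))) (sumTo-+ℕ (N ∸ 1) _)
          below : ∀ i → i < N ∸ 1 → P i ≡ true → g i < E
          below i _ Pi = eʲ<E (suc (suc i)) (dec-sound (suc (suc i) ∣? N) Pi) (λ ())
          decreasing : ∀ i i′ → i < i′ → i′ < N ∸ 1 → P i ≡ true → P i′ ≡ true → g i′ < g i
          decreasing i i′ i<i′ _ Pi Pi′ = eʲ-mono (suc (suc i′)) (suc (suc i)) j′∣N j∣N (cofactor-anti (suc (suc i)) (suc (suc i′)) j∣N j′∣N (s≤s (s≤s i<i′)))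
            where
            j∣N : suc (suc i) ∣ N
            j∣N = dec-sound (suc (suc i) ∣? N) Pi
            j′∣N : suc (suc i′) ∣ N
            j′∣N = dec-sound (suc (suc i′) ∣? N) Pi′
        -V≤ε*rest : - V ℤ.≤ ε * rest
        -V≤ε*rest = subst₂ ℤ._≤_ (sumTo-neg (N ∸ 1) _) (sumTo-* (N ∸ 1) ε _) (sumTo-mono (N ∸ 1) _ _ termwise)
          where
          termwise : ∀ i → i < N ∸ 1 → - when (P i) (x ℤ.^ g i) ℤ.≤ ε * when (P i) (f (suc (suc i)))
          termwise i _ with P i
          ... | false = ℤP.≤-reflexive (sym (ℤP.*-zeroʳ ε))
          ... | true = subst (- (x ℤ.^ g i) ℤ.≤_) (ℤP.*-assoc ε (wʲ (suc (suc i))) (x ℤ.^ g i))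
            (Sign-bound (Sign-* (Sign-neg1^ (k ℕ.* (n ∸ (n ÷ d)))) (Sign-* (Sign-μ (suc (suc i))) (Sign-neg1^ (k ℕ.* (n ∸ cofactor N (suc (suc i))))))) (x ℤ.^ g i)
              (subst (+ 0 ℤ.≤_) (sym (pow-pos q (g i))) (ℤ.+≤+ z≤n)))

      sign-of-a-at-prime-power : ∀ q → IsPrimePower q → + 0 ℤ.< ε * eval a (+ q)
      sign-of-a-at-prime-power q q-prime-power = *-cancelʳ-pos (ε * eval a x) (q^e-1>0 q n q≥2 n≥1)
        (subst (+ 0 ℤ.<_) (sym key) (*-pos (q^e-1>0 q d q≥2 (s≤s z≤n)) (ε*S>0 q q≥2)))
        where
        q≥2 : 2 ≤ q
        q≥2 = primePower≥2 q q-prime-power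
        x : ℤ
        x = + q
        a[x]*[xⁿ-1] : eval a x * (x ℤ.^ n + - + 1) ≡ (x ℤ.^ d + - + 1) * eval (S k n d) x
        a[x]*[xⁿ-1] = begin
          eval a x * (x ℤ.^ n + - + 1)                   ≡⟨ cong (eval a x *_) (sym (eval-X^-1 n x)) ⟩
          eval a x * eval (X^ n -ₚ C (+ 1)) x            ≡⟨ sym (eval-*ₚ a (X^ n -ₚ C (+ 1)) x) ⟩
          eval (a *ₚ (X^ n -ₚ C (+ 1))) x                ≡⟨ eval-≈ₚ (a *ₚ (X^ n -ₚ C (+ 1))) ((X^ d -ₚ C (+ 1)) *ₚ S k n d) x isA ⟩
          eval ((X^ d -ₚ C (+ 1)) *ₚ S k n d) x          ≡⟨ eval-*ₚ (X^ d -ₚ C (+ 1)) (S k n d) x ⟩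
          eval (X^ d -ₚ C (+ 1)) x * eval (S k n d) x    ≡⟨ cong (_* eval (S k n d) x) (eval-X^-1 d x) ⟩
          (x ℤ.^ d + - + 1) * eval (S k n d) x           ∎
          where open ≡-Reasoning
        key : ε * eval a x * (x ℤ.^ n + - + 1) ≡ (x ℤ.^ d + - + 1) * (ε * eval (S k n d) x)
        key = trans (ℤP.*-assoc ε _ _) (trans (cong (ε *_) a[x]*[xⁿ-1]) (lem ε (x ℤ.^ d + - + 1) (eval (S k n d) x)))
          where
          lem : ∀ e b s → e * (b * s) ≡ b * (e * s)
          lem = solve-∀

open import Data.Nat using (ℕ; zero; suc; _≤_; _<_; _∸_; _*_; _+_; _≟_; s≤s; z≤n)
open import Data.Integer using (ℤ; +_; -_) renaming (_*_ to _*ℤ_; _<_ to _<ℤ_; _-_ to _-ℤ_)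

lemma2p7 : (k n d : ℕ) → 2 ≤ k → 1 ≤ n → d ∣ n →
  Σ Poly λ a → IsA k n d a
    -- (I)
    × (d ≢ n → 2 * d ≢ n → Σ Poly λ r → r *ₚ (X^ d -ₚ C (+ 1)) ≈ₚ a)
    × (d ≡ n → a ≈ₚ C (neg1^ (k * (n ∸ 1))))
    × (2 * d ≡ n → a *ₚ (X^ d +ₚ C (+ 1)) ≈ₚ X^ ((k ∸ 2) * d) +ₚ C (neg1^ (k + 1)))
    -- (II)
    × (2 < k → Σ ℕ λ D → HasDegLead a D (neg1^ (k * (n ∸ (n ÷ d))))
                 × (+ (2 * d * D) ≡ ((+ n *ℤ (+ k -ℤ + 2)) -ℤ + (2 * d)) *ℤ (+ n -ℤ + d)))
    × (k ≡ 2 → a ≈ₚ C (δ (n ≟ d)))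
    -- (III)
    × (2 < k → (q : ℕ) → IsPrimePower q → + 0 <ℤ neg1^ (k * (n ∸ (n ÷ d))) *ℤ eval a (+ q))
lemma2p7 k n zero _ 1≤n (divides N n≡N*0) = ⊥-elim (ℕP.<⇒≱ 1≤n (ℕP.≤-reflexive (trans n≡N*0 (ℕP.*-zeroʳ N))))
lemma2p7 k .(zero * suc d') (suc d') _ () (divides zero refl)
lemma2p7 k .(suc N' * suc d') (suc d') 2≤k _ (divides (suc N') refl) =
  a , isA , Xᵈ-1-divides-a , a-when-d≡n , a*Xᵈ+1-when-2d≡n ,
  LeadingTerm.degree-and-lead-of-a , a-when-k≡2 , LeadingTerm.sign-of-a-at-prime-power
  where
  open Construction k (suc N') d' 2≤k (s≤s z≤n)
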